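{- Let $m\ge4$ be even and let $a,b$ be integers of the same parity with $1\le a<b<m$. Then $B_3(m;a,b)$ is a nut graph if and only if $a$ and $b$ are odd, $\gcd(m,a)=\gcd(m,b)=1$ and $v_2(b-a)\ge v_2(m)$.
   Context: A graph is a nut graph if $0$ is an adjacency eigenvalue of multiplicity one and a corresponding eigenvector has no zero entries. $B_3(m;a,b)$ is the graph on vertices $x_0,\dots,x_{m-1},y_0,\dots,y_{m-1}$ (indices mod $m$) with edges $x_ix_{i+m/2}$, $y_iy_{i+m/2}$, $x_iy_i$, $x_iy_{i+a}$ and $x_iy_{i+b}$ for all $i$. For a nonzero integer $x$, $v_2(x)$ is the exponent of $2$ in the prime factorization of $|x|$. -}

module Defs where

open import Data.Nat using (ℕ; zero; suc; _+_; _≡ᵇ_; NonZero)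
open import Data.Nat.DivMod using (_%_; _/_)
open import Data.Bool using (Bool; true; false; _∨_; if_then_else_)
open import Data.Fin using (Fin; toℕ; splitAt)
open import Data.Sum using (_⊎_; inj₁; inj₂)
open import Data.Product using (Σ; _×_; ∃)
open import Data.Rational using (ℚ; 0ℚ; 1ℚ) renaming (_+_ to _+ℚ_; _*_ to _*ℚ_)
open import Relation.Binary.PropositionalEquality using (_≡_; _≢_)

sumFin : (n : ℕ) → (Fin n → ℚ) → ℚ
sumFin zero    f = 0ℚ
sumFin (suc n) f = f Fin.zero +ℚ sumFin n (λ i → f (Fin.suc i))

_·_ : {n : ℕ} → (Fin n → Fin n → ℚ) → (Fin n → ℚ) → (Fin n → ℚ)
_·_ {n} M x u = sumFin n (λ v → M u v *ℚ x v)

InKernel : {n : ℕ} → (Fin n → Fin n → ℚ) → (Fin n → ℚ) → Set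
InKernel M x = ∀ u → (M · x) u ≡ 0ℚ

-- A (symmetric) adjacency matrix M is a nut graph matrix: the 0-eigenspace
-- is one-dimensional (for a real symmetric matrix the multiplicity of the
-- eigenvalue 0 equals the nullity), spanned by a vector with no zero entries.
IsNut : {n : ℕ} → (Fin n → Fin n → ℚ) → Set
IsNut {n} M =
  Σ (Fin n → ℚ) λ x →
    (∀ u → x u ≢ 0ℚ) × InKernel M x ×
    (∀ y → InKernel M y → ∃ λ (c : ℚ) → ∀ u → y u ≡ c *ℚ x u)

-- The graph B₃(m; a, b).  Vertices: inj₁ i = x_i, inj₂ i = y_i.

adjB3 : (m a b : ℕ) → .{{NonZero m}} → Fin m ⊎ Fin m → Fin m ⊎ Fin m → Bool
adjB3 m a b (inj₁ i) (inj₁ j) = toℕ j ≡ᵇ ((toℕ i + m / 2) % m)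
adjB3 m a b (inj₂ i) (inj₂ j) = toℕ j ≡ᵇ ((toℕ i + m / 2) % m)
adjB3 m a b (inj₁ i) (inj₂ j) =
  (toℕ j ≡ᵇ (toℕ i % m)) ∨ (toℕ j ≡ᵇ ((toℕ i + a) % m)) ∨ (toℕ j ≡ᵇ ((toℕ i + b) % m))
adjB3 m a b (inj₂ j) (inj₁ i) =
  (toℕ j ≡ᵇ (toℕ i % m)) ∨ (toℕ j ≡ᵇ ((toℕ i + a) % m)) ∨ (toℕ j ≡ᵇ ((toℕ i + b) % m))

-- Adjacency matrix of B₃(m; a, b) on Fin (m + m): index k < m is x_k,
-- index m + k is y_k.
B3 : (m a b : ℕ) → .{{NonZero m}} → Fin (m + m) → Fin (m + m) → ℚ
B3 m a b u v = if adjB3 m a b (splitAt m u) (splitAt m v) then 1ℚ else 0ℚ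

-- 2-adic valuation of a positive natural number (v₂ 0 = 0 by convention,
-- never used on 0 here).

v2-fuel : ℕ → ℕ → ℕ
v2-fuel zero     n = 0
v2-fuel (suc f) zero = 0
v2-fuel (suc f) (suc k) =
  if (suc k % 2) ≡ᵇ 0 then suc (v2-fuel f (suc k / 2)) else 0

v2 : ℕ → ℕ
v2 n = v2-fuel n n

{-# OPTIONS --safe #-}

-- A vector on B₃(m; a, b) is a pair (X, Y) of m-periodic functions (its values at x_k and y_k).
-- With T the shift, h = m/2 and d = b − a, the rows at the y's give Y = −Tʰ(1 + T⁻ᵃ + T⁻ᵇ) X,
-- and substituting into the rows at the x's leaves Φ X = 0 with Φ = (1 + Tᵈ)(1 + Tᵃ)(1 + Tᵇ).
-- If a, b are odd, X = (−1)ᵏ is a nowhere-zero solution. If moreover gcd(m, a) = gcd(m, b) = 1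
-- and m divides an odd multiple of d (that is, v₂ m ≤ v₂ d), the factors of Φ can be peeled off:
-- 1 + Tᵈ is injective, the kernels of 1 + Tᵃ and 1 + Tᵇ are spanned by (−1)ᵏ, and
-- (1 + Tᵇ) g = α (−1)ᵏ forces α = 0 since ℚ has characteristic 0. So the kernel is a line.
-- Conversely, if a and b are even then X ↦ (−1)ᵏ X preserves ker Φ, giving a second kernel vector.
-- If t = gcd(m, c) > 1 for c ∈ {a, b}, or t = 2^(v₂ d) with v₂ d < v₂ m, then k ↦ [t ∣ k] (−1)^(k/t)
-- is killed by 1 + Tᶜ (c = d in the second case), hence by Φ; it vanishes at 1 but not at 0,
-- so it is not a multiple of a nowhere-zero kernel vector.
module Submission where

open import Defs

open import Data.Nat using (ℕ; zero; suc; _+_; _*_; _^_; _≤_; _<_; _∸_; _%_; _/_; _≡ᵇ_; NonZero; z≤n; s≤s; s≤s⁻¹)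
import Data.Nat.Properties as ℕP
import Data.Nat as ℕ
open import Data.Nat.DivMod
  using (_mod_; m≡m%n+[m/n]*n; m%n<n; m<n⇒m%n≡m; [m+n]%n≡m%n; [m+kn]%n≡m%n; %-distribˡ-+; m%n%n≡m%n;
         m/n<m; m/n*n≡m; m*n/n≡m; 0/n≡0; +-distrib-/-∣ʳ)
open import Data.Nat.Divisibility using (_∣_; divides; ∣m+n∣m⇒∣n; n∣m*n; ∣⇒≤; m%n≡0⇒n∣m)
open import Data.Nat.GCD using (gcd; module Bézout; gcd[m,n]∣m; gcd[m,n]∣n; gcd[m,n]≢0)
open import Data.Nat.Coprimality using (coprime-Bézout; gcd≡1⇒coprime)
import Data.Nat.Tactic.RingSolver as ℕ-Solver
open import Data.Rational using (ℚ; 0ℚ; 1ℚ; -_; _-_) renaming (_+_ to _+ℚ_; _*_ to _*ℚ_)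
import Data.Rational as ℚ
import Data.Rational.Properties as ℚP
open import Data.Product using (_×_; _,_; proj₁; proj₂; ∃-syntax)
open import Data.Bool using (Bool; true; false; _∨_; if_then_else_; T)
open import Data.Bool.Properties using (T-∨)
open import Function.Bundles using (_⇔_; mk⇔; Equivalence)
open import Data.Unit using (tt)
open import Data.Fin using (Fin; toℕ; _↑ˡ_; _↑ʳ_; splitAt)
import Data.Fin.Properties as FinP
open import Function.Base using (_∘_)
open import Data.Sum using (_⊎_; inj₁; inj₂; [_,_]′)
open import Data.Empty using (⊥; ⊥-elim)
open import Data.List using (_∷_; [])
open import Relation.Binary.PropositionalEquality
  using (_≡_; _≢_; refl; sym; trans; cong; cong₂; subst; module ≡-Reasoning)
open import Relation.Nullary.Decidable using (dec⇒maybe; yes; no)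
import Tactic.RingSolver.Core.AlmostCommutativeRing as ACR
open import Tactic.RingSolver using (solve-∀)
open import Algebra.Bundles using (Ring; AbelianGroup)
open import Algebra.Properties.Semiring.Sum (Ring.semiring ℚP.+-*-ring)
  using (sum; sum-cong-≗; ∑-distrib-+; sum-replicate-zero)
import Algebra.Properties.CommutativeSemigroup ℕP.+-commutativeSemigroup as ℕ+
import Algebra.Properties.CommutativeSemigroup (AbelianGroup.commutativeSemigroup ℚP.+-0-abelianGroup) as ℚ+
open import Algebra.Properties.Ring ℚP.+-*-ring using (-1*x≈-x)
open import Algebra.Properties.Group ℚP.+-0-group using (inverseʳ-unique; ⁻¹-involutive; x∙y⁻¹≈ε⇒x≈y)
open import Algebra.Properties.Monoid.Mult ℚP.+-0-monoid using () renaming (_×_ to _⨯_)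
open import Algebra.Properties.Semiring.Mult (Ring.semiring ℚP.+-*-ring) using (×-assoc-*)

ℚ-ring : ACR.AlmostCommutativeRing _ _
ℚ-ring = ACR.fromCommutativeRing ℚP.+-*-commutativeRing (λ x → dec⇒maybe (0ℚ ℚP.≟ x))

-1ℚ : ℚ
-1ℚ = - 1ℚ

1≢-1 : 1ℚ ≢ -1ℚ
1≢-1 ()

p*q≡0⇒p≡0 : ∀ {p q} → q ≢ 0ℚ → p *ℚ q ≡ 0ℚ → p ≡ 0ℚ
p*q≡0⇒p≡0 {p} {q} q≢0 pq≡0 = begin
  p                  ≡⟨ sym (ℚP.*-identityʳ p) ⟩
  p *ℚ 1ℚ            ≡⟨ cong (p *ℚ_) (sym (ℚP.*-inverseʳ q)) ⟩
  p *ℚ (q *ℚ q⁻¹)    ≡⟨ sym (ℚP.*-assoc p q q⁻¹) ⟩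
  (p *ℚ q) *ℚ q⁻¹    ≡⟨ cong (_*ℚ q⁻¹) pq≡0 ⟩
  0ℚ *ℚ q⁻¹          ≡⟨ ℚP.*-zeroˡ q⁻¹ ⟩
  0ℚ                 ∎
  where
  open ≡-Reasoning
  instance _ = ℚ.≢-nonZero q≢0
  q⁻¹ = ℚ.1/ q

*-cancelʳ-≡ : ∀ {p p′ q} → q ≢ 0ℚ → p *ℚ q ≡ p′ *ℚ q → p ≡ p′
*-cancelʳ-≡ {p} {p′} {q} q≢0 pq≡p′q = x∙y⁻¹≈ε⇒x≈y p p′ (p*q≡0⇒p≡0 q≢0 (begin
  (p - p′) *ℚ q           ≡⟨ expand p p′ q ⟩
  p *ℚ q - p′ *ℚ q        ≡⟨ cong (_- p′ *ℚ q) pq≡p′q ⟩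
  p′ *ℚ q - p′ *ℚ q       ≡⟨ ℚP.+-inverseʳ (p′ *ℚ q) ⟩
  0ℚ                      ∎))
  where
  open ≡-Reasoning
  expand : ∀ x y z → (x - y) *ℚ z ≡ x *ℚ z - y *ℚ z
  expand = solve-∀ ℚ-ring

p≡-p⇒p≡0 : ∀ {p} → p ≡ - p → p ≡ 0ℚ
p≡-p⇒p≡0 {p} p≡-p = p*q≡0⇒p≡0 {q = 1ℚ +ℚ 1ℚ} (λ ()) (begin
  p *ℚ (1ℚ +ℚ 1ℚ)    ≡⟨ double p ⟩
  p +ℚ p             ≡⟨ cong (p +ℚ_) p≡-p ⟩
  p +ℚ - p           ≡⟨ ℚP.+-inverseʳ p ⟩
  0ℚ                 ∎)
  where
  open ≡-Reasoning
  double : ∀ x → x *ℚ (1ℚ +ℚ 1ℚ) ≡ x +ℚ x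
  double = solve-∀ ℚ-ring

suc⨯1-positive : ∀ n → 0ℚ ℚ.< suc n ⨯ 1ℚ
suc⨯1-positive n = ℚP.+-mono-<-≤ (ℚP.positive⁻¹ 1ℚ) (⨯1-nonNegative n)
  where
  ⨯1-nonNegative : ∀ n → 0ℚ ℚ.≤ n ⨯ 1ℚ
  ⨯1-nonNegative zero    = ℚP.≤-refl
  ⨯1-nonNegative (suc n) = ℚP.<⇒≤ (suc⨯1-positive n)

n⨯p≡0⇒p≡0 : ∀ n .{{_ : NonZero n}} {p} → n ⨯ p ≡ 0ℚ → p ≡ 0ℚ
n⨯p≡0⇒p≡0 (suc n) {p} e = p*q≡0⇒p≡0 (λ N≡0 → ℚP.<⇒≢ (suc⨯1-positive n) (sym N≡0)) (begin
  p *ℚ (suc n ⨯ 1ℚ)     ≡⟨ ℚP.*-comm p (suc n ⨯ 1ℚ) ⟩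
  (suc n ⨯ 1ℚ) *ℚ p     ≡⟨ ×-assoc-* (suc n) 1ℚ p ⟩
  suc n ⨯ (1ℚ *ℚ p)     ≡⟨ cong (suc n ⨯_) (ℚP.*-identityˡ p) ⟩
  suc n ⨯ p             ≡⟨ e ⟩
  0ℚ                    ∎)
  where open ≡-Reasoning

parity : ∀ n → n % 2 ≡ 0 ⊎ n % 2 ≡ 1
parity n with n % 2 | m%n<n n 2
... | 0           | _                 = inj₁ refl
... | 1           | _                 = inj₂ refl
... | suc (suc _) | s≤s (s≤s ())

sgn : ℕ → ℚ
sgn zero    = 1ℚ
sgn (suc n) = - sgn n

sgn-+ : ∀ m n → sgn (m + n) ≡ sgn m *ℚ sgn n
sgn-+ zero    n = sym (ℚP.*-identityˡ (sgn n))
sgn-+ (suc m) n = trans (cong -_ (sgn-+ m n)) (ℚP.neg-distribˡ-* (sgn m) (sgn n))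

sgn-shift : ∀ {c s} → sgn c ≡ s → ∀ k → sgn (k + c) ≡ sgn k *ℚ s
sgn-shift {c} sgn-c k = trans (sgn-+ k c) (cong (sgn k *ℚ_) sgn-c)

sgn≡±1 : ∀ n → sgn n ≡ 1ℚ ⊎ sgn n ≡ -1ℚ
sgn≡±1 zero    = inj₁ refl
sgn≡±1 (suc n) with sgn≡±1 n
... | inj₁ e = inj₂ (cong -_ e)
... | inj₂ e = inj₁ (cong -_ e)

sgn*sgn : ∀ n → sgn n *ℚ sgn n ≡ 1ℚ
sgn*sgn n with sgn≡±1 n
... | inj₁ e rewrite e = refl
... | inj₂ e rewrite e = refl

sgn≢0 : ∀ n → sgn n ≢ 0ℚ
sgn≢0 n with sgn≡±1 n
... | inj₁ e = λ e′ → ℚP.1≢0 (trans (sym e) e′)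
... | inj₂ e = λ e′ → ℚP.1≢0 (ℚP.neg-injective (trans (sym e) e′))

sgn-*-even : ∀ {c} → sgn c ≡ 1ℚ → ∀ n → sgn (n * c) ≡ 1ℚ
sgn-*-even e zero    = refl
sgn-*-even {c} e (suc n) = begin
  sgn (c + n * c)          ≡⟨ sgn-+ c (n * c) ⟩
  sgn c *ℚ sgn (n * c)     ≡⟨ cong₂ _*ℚ_ e (sgn-*-even e n) ⟩
  1ℚ                       ∎
  where open ≡-Reasoning

sgn-*-odd : ∀ {c} → sgn c ≡ -1ℚ → ∀ n → sgn (n * c) ≡ sgn n
sgn-*-odd e zero    = refl
sgn-*-odd {c} e (suc n) = begin
  sgn (c + n * c)          ≡⟨ sgn-+ c (n * c) ⟩
  sgn c *ℚ sgn (n * c)     ≡⟨ cong₂ _*ℚ_ e (sgn-*-odd e n) ⟩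
  -1ℚ *ℚ sgn n             ≡⟨ -1*x≈-x (sgn n) ⟩
  - sgn n                  ∎
  where open ≡-Reasoning

sgn-even : ∀ {n} → 2 ∣ n → sgn n ≡ 1ℚ
sgn-even (divides q refl) = sgn-*-even refl q

sgn-odd : ∀ {n} → n % 2 ≡ 1 → sgn n ≡ -1ℚ
sgn-odd {n} n%2≡1 = begin
  sgn n                           ≡⟨ cong sgn (m≡m%n+[m/n]*n n 2) ⟩
  sgn (n % 2 + n / 2 * 2)         ≡⟨ cong (λ r → sgn (r + n / 2 * 2)) n%2≡1 ⟩
  - sgn (n / 2 * 2)               ≡⟨ cong -_ (sgn-*-even refl (n / 2)) ⟩
  -1ℚ                             ∎
  where open ≡-Reasoning

sgn-odd-factors : ∀ o g → sgn (o * g) ≡ -1ℚ → sgn o ≡ -1ℚ × sgn g ≡ -1ℚ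
sgn-odd-factors o g e with sgn≡±1 g
... | inj₁ g-even = ⊥-elim (1≢-1 (trans (sym (sgn-*-even g-even o)) e))
... | inj₂ g-odd  = trans (sym (sgn-*-odd g-odd o)) e , g-odd

sgn-∸ : ∀ {a b} → a ≤ b → sgn (b ∸ a) ≡ sgn a *ℚ sgn b
sgn-∸ {a} {b} a≤b = begin
  sgn (b ∸ a)                         ≡⟨ ℚP.*-identityˡ (sgn (b ∸ a)) ⟨
  1ℚ *ℚ sgn (b ∸ a)                   ≡⟨ cong (_*ℚ sgn (b ∸ a)) (sgn*sgn a) ⟨
  (sgn a *ℚ sgn a) *ℚ sgn (b ∸ a)     ≡⟨ ℚP.*-assoc (sgn a) (sgn a) (sgn (b ∸ a)) ⟩
  sgn a *ℚ (sgn a *ℚ sgn (b ∸ a))     ≡⟨ cong (sgn a *ℚ_) (sgn-+ a (b ∸ a)) ⟨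
  sgn a *ℚ sgn (a + (b ∸ a))          ≡⟨ cong (λ t → sgn a *ℚ sgn t) (ℕP.m+[n∸m]≡n a≤b) ⟩
  sgn a *ℚ sgn b                      ∎
  where open ≡-Reasoning

Periodic : ℕ → (ℕ → ℚ) → Set
Periodic p F = ∀ k → F (k + p) ≡ F k

periodic-* : ∀ {p F} → Periodic p F → ∀ k n → F (k + n * p) ≡ F k
periodic-* {p} {F} per k zero    = cong F (ℕP.+-identityʳ k)
periodic-* {p} {F} per k (suc n) = begin
  F (k + (p + n * p))   ≡⟨ cong F (ℕ-Solver.solve (k ∷ p ∷ n ∷ [])) ⟩
  F (k + n * p + p)     ≡⟨ per (k + n * p) ⟩
  F (k + n * p)         ≡⟨ periodic-* per k n ⟩
  F k                   ∎
  where open ≡-Reasoning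

periodic-shift : ∀ {p F} c → Periodic p F → Periodic p (λ k → F (k + c))
periodic-shift {p} {F} c per k = trans (cong F (ℕ+.xy∙z≈xz∙y k p c)) (per (k + c))

periodic-% : ∀ {m F} .{{_ : NonZero m}} → Periodic m F → ∀ k → F (k % m) ≡ F k
periodic-% {m} {F} per k = begin
  F (k % m)                   ≡⟨ periodic-* per (k % m) (k / m) ⟨
  F (k % m + k / m * m)       ≡⟨ cong F (m≡m%n+[m/n]*n k m) ⟨
  F k                         ∎
  where open ≡-Reasoning

coprime-periods⇒constant : ∀ {p q F} → Periodic p F → Periodic q F → gcd p q ≡ 1 →
                           ∀ k → F k ≡ F 0
coprime-periods⇒constant {p} {q} {F} per-p per-q gcd≡1 = constant
  where
  open ≡-Reasoning
  step : ∀ {r s} → Periodic r F → Periodic s F → ∀ x y → 1 + y * s ≡ x * r →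
         ∀ k → F (suc k) ≡ F k
  step {r} {s} per-r per-s x y eq k = begin
    F (suc k)             ≡⟨ periodic-* per-s (suc k) y ⟨
    F (suc k + y * s)     ≡⟨ cong F (ℕP.+-suc k (y * s)) ⟨
    F (k + (1 + y * s))   ≡⟨ cong (λ t → F (k + t)) eq ⟩
    F (k + x * r)         ≡⟨ periodic-* per-r k x ⟩
    F k                   ∎
  step₁ : ∀ k → F (suc k) ≡ F k
  step₁ with coprime-Bézout (gcd≡1⇒coprime gcd≡1)
  ... | Bézout.+- x y eq = step per-p per-q x y eq
  ... | Bézout.-+ x y eq = step per-q per-p y x eq
  constant : ∀ k → F k ≡ F 0
  constant zero    = refl
  constant (suc k) = trans (step₁ k) (constant k)

sgn-periodic : ∀ {m} → sgn m ≡ 1ℚ → Periodic m sgn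
sgn-periodic m-even k = trans (sgn-shift m-even k) (ℚP.*-identityʳ (sgn k))

1+T^ : ℕ → (ℕ → ℚ) → ℕ → ℚ
1+T^ c F k = F k +ℚ F (k + c)

1+T^-periodic : ∀ {m F} c → Periodic m F → Periodic m (1+T^ c F)
1+T^-periodic c per k = cong₂ _+ℚ_ (per k) (periodic-shift c per k)

1+T^-comm : ∀ c e F k → 1+T^ c (1+T^ e F) k ≡ 1+T^ e (1+T^ c F) k
1+T^-comm c e F k = begin
  (F k +ℚ F (k + e)) +ℚ (F (k + c) +ℚ F (k + c + e))
    ≡⟨ cong (λ t → (F k +ℚ F (k + e)) +ℚ (F (k + c) +ℚ F t)) (ℕ+.xy∙z≈xz∙y k c e) ⟩
  (F k +ℚ F (k + e)) +ℚ (F (k + c) +ℚ F (k + e + c))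
    ≡⟨ ℚ+.interchange (F k) (F (k + e)) (F (k + c)) (F (k + e + c)) ⟩
  (F k +ℚ F (k + c)) +ℚ (F (k + e) +ℚ F (k + e + c)) ∎
  where open ≡-Reasoning

1+T^-cong : ∀ c {F G} → (∀ k → F k ≡ G k) → ∀ k → 1+T^ c F k ≡ 1+T^ c G k
1+T^-cong c F≗G k = cong₂ _+ℚ_ (F≗G k) (F≗G (k + c))

1+T^-zero : ∀ c {F} → (∀ k → F k ≡ 0ℚ) → ∀ k → 1+T^ c F k ≡ 0ℚ
1+T^-zero c F≗0 k = cong₂ _+ℚ_ (F≗0 k) (F≗0 (k + c))

1+T^-sgn : ∀ {c} → sgn c ≡ -1ℚ → ∀ k → 1+T^ c sgn k ≡ 0ℚ
1+T^-sgn c-odd k = trans (cong (sgn k +ℚ_) (sgn-shift c-odd k)) (cancel (sgn k))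
  where
  cancel : ∀ s → s +ℚ s *ℚ -1ℚ ≡ 0ℚ
  cancel = solve-∀ ℚ-ring

alternate : (ℕ → ℚ) → ℕ → ℚ
alternate F k = sgn k *ℚ F k

alternate-periodic : ∀ {m F} → sgn m ≡ 1ℚ → Periodic m F → Periodic m (alternate F)
alternate-periodic {m} {F} m-even per k = begin
  sgn (k + m) *ℚ F (k + m)     ≡⟨ cong₂ _*ℚ_ (sgn-shift m-even k) (per k) ⟩
  (sgn k *ℚ 1ℚ) *ℚ F k         ≡⟨ cong (_*ℚ F k) (ℚP.*-identityʳ (sgn k)) ⟩
  sgn k *ℚ F k                 ∎
  where open ≡-Reasoning

alternate-involutive : ∀ F k → alternate (alternate F) k ≡ F k
alternate-involutive F k = begin
  sgn k *ℚ (sgn k *ℚ F k)      ≡⟨ ℚP.*-assoc (sgn k) (sgn k) (F k) ⟨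
  (sgn k *ℚ sgn k) *ℚ F k      ≡⟨ cong (_*ℚ F k) (sgn*sgn k) ⟩
  1ℚ *ℚ F k                    ≡⟨ ℚP.*-identityˡ (F k) ⟩
  F k                          ∎
  where open ≡-Reasoning

1+T^-alternate-even : ∀ {c} → sgn c ≡ 1ℚ → ∀ F k → 1+T^ c (alternate F) k ≡ alternate (1+T^ c F) k
1+T^-alternate-even {c} c-even F k = begin
  sgn k *ℚ F k +ℚ sgn (k + c) *ℚ F (k + c)
    ≡⟨ cong (λ s → sgn k *ℚ F k +ℚ s *ℚ F (k + c)) (trans (sgn-shift c-even k) (ℚP.*-identityʳ (sgn k))) ⟩
  sgn k *ℚ F k +ℚ sgn k *ℚ F (k + c)   ≡⟨ ℚP.*-distribˡ-+ (sgn k) (F k) (F (k + c)) ⟨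
  sgn k *ℚ (F k +ℚ F (k + c))          ∎
  where open ≡-Reasoning

alternate-step-odd : ∀ {c} → sgn c ≡ -1ℚ → ∀ F k → alternate F (k + c) ≡ alternate F k - sgn k *ℚ 1+T^ c F k
alternate-step-odd {c} c-odd F k = begin
  sgn (k + c) *ℚ F (k + c)             ≡⟨ cong (_*ℚ F (k + c)) (sgn-shift c-odd k) ⟩
  (sgn k *ℚ -1ℚ) *ℚ F (k + c)          ≡⟨ rearrange (sgn k) (F k) (F (k + c)) ⟩
  sgn k *ℚ F k - sgn k *ℚ (F k +ℚ F (k + c)) ∎
  where
  open ≡-Reasoning
  rearrange : ∀ s x y → (s *ℚ -1ℚ) *ℚ y ≡ s *ℚ x - s *ℚ (x +ℚ y)
  rearrange = solve-∀ ℚ-ring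

-- alternate F has the periods m and c, so it is constant.
antiperiodic⇒alternating : ∀ {m c F} → sgn m ≡ 1ℚ → sgn c ≡ -1ℚ → gcd m c ≡ 1 → Periodic m F →
                           (∀ k → 1+T^ c F k ≡ 0ℚ) → ∀ k → F k ≡ F 0 *ℚ sgn k
antiperiodic⇒alternating {m} {c} {F} m-even c-odd gcd≡1 per F-anti k = begin
  F k                            ≡⟨ alternate-involutive F k ⟨
  sgn k *ℚ alternate F k         ≡⟨ cong (sgn k *ℚ_) (G-constant k) ⟩
  sgn k *ℚ (1ℚ *ℚ F 0)           ≡⟨ cong (sgn k *ℚ_) (ℚP.*-identityˡ (F 0)) ⟩
  sgn k *ℚ F 0                   ≡⟨ ℚP.*-comm (sgn k) (F 0) ⟩
  F 0 *ℚ sgn k                   ∎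
  where
  open ≡-Reasoning
  G-period-c : Periodic c (alternate F)
  G-period-c k = begin
    alternate F (k + c)                       ≡⟨ alternate-step-odd c-odd F k ⟩
    alternate F k - sgn k *ℚ 1+T^ c F k       ≡⟨ cong (λ t → alternate F k - sgn k *ℚ t) (F-anti k) ⟩
    alternate F k - sgn k *ℚ 0ℚ               ≡⟨ sub-zero (alternate F k) (sgn k) ⟩
    alternate F k                             ∎
    where
    sub-zero : ∀ x s → x - s *ℚ 0ℚ ≡ x
    sub-zero = solve-∀ ℚ-ring
  G-constant : ∀ k → alternate F k ≡ alternate F 0
  G-constant = coprime-periods⇒constant (alternate-periodic m-even per) G-period-c gcd≡1

-- alternate g drops by α at every step c, yet returns to its value after m steps.
alternating-drift⇒0 : ∀ {m c g} .{{_ : NonZero m}} α → sgn m ≡ 1ℚ → sgn c ≡ -1ℚ → Periodic m g →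
                      (∀ k → 1+T^ c g k ≡ α *ℚ sgn k) → α ≡ 0ℚ
alternating-drift⇒0 {m} {c} {g} α m-even c-odd per drift = n⨯p≡0⇒p≡0 m (begin
  m ⨯ α                       ≡⟨ sub-sub (G 0) (m ⨯ α) ⟩
  G 0 - (G 0 - m ⨯ α)         ≡⟨ cong (λ t → G 0 - t) (G-orbit m) ⟨
  G 0 - G (m * c)             ≡⟨ cong (λ t → G 0 - G t) (ℕP.*-comm m c) ⟩
  G 0 - G (0 + c * m)         ≡⟨ cong (λ t → G 0 - t) (periodic-* (alternate-periodic m-even per) 0 c) ⟩
  G 0 - G 0                   ≡⟨ ℚP.+-inverseʳ (G 0) ⟩
  0ℚ                          ∎)
  where
  open ≡-Reasoning
  G = alternate g
  sub-sub : ∀ x y → y ≡ x - (x - y)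
  sub-sub = solve-∀ ℚ-ring
  G-step : ∀ k → G (k + c) ≡ G k - α
  G-step k = begin
    G (k + c)                         ≡⟨ alternate-step-odd c-odd g k ⟩
    G k - sgn k *ℚ 1+T^ c g k         ≡⟨ cong (λ t → G k - sgn k *ℚ t) (drift k) ⟩
    G k - sgn k *ℚ (α *ℚ sgn k)       ≡⟨ regroup (G k) (sgn k) α ⟩
    G k - α *ℚ (sgn k *ℚ sgn k)       ≡⟨ cong (λ t → G k - α *ℚ t) (sgn*sgn k) ⟩
    G k - α *ℚ 1ℚ                     ≡⟨ cong (λ t → G k - t) (ℚP.*-identityʳ α) ⟩
    G k - α                           ∎
    where
    regroup : ∀ x s a → x - s *ℚ (a *ℚ s) ≡ x - a *ℚ (s *ℚ s)
    regroup = solve-∀ ℚ-ring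
  G-orbit : ∀ n → G (n * c) ≡ G 0 - n ⨯ α
  G-orbit zero    = sub-zero (G 0)
    where
    sub-zero : ∀ x → x ≡ x - 0ℚ
    sub-zero = solve-∀ ℚ-ring
  G-orbit (suc n) = begin
    G (c + n * c)               ≡⟨ cong G (ℕP.+-comm c (n * c)) ⟩
    G (n * c + c)               ≡⟨ G-step (n * c) ⟩
    G (n * c) - α               ≡⟨ cong (_- α) (G-orbit n) ⟩
    (G 0 - n ⨯ α) - α           ≡⟨ sub-sub-+ (G 0) (n ⨯ α) α ⟩
    G 0 - (α +ℚ n ⨯ α)          ∎
    where
    sub-sub-+ : ∀ x y z → (x - y) - z ≡ x - (z +ℚ y)
    sub-sub-+ = solve-∀ ℚ-ring

-- F has period 2d, and an odd multiple of d is a multiple of m, so d is a period too: F = - F.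
oddMultiple-antiperiodic⇒0 : ∀ {m d o F} → m ∣ o * d → o % 2 ≡ 1 → Periodic m F →
                             (∀ k → 1+T^ d F k ≡ 0ℚ) → ∀ k → F k ≡ 0ℚ
oddMultiple-antiperiodic⇒0 {m} {d} {o} {F} (divides t od≡tm) o%2≡1 per F-anti k =
  p≡-p⇒p≡0 (trans (sym F-d-periodic) (flip k))
  where
  open ≡-Reasoning
  flip : ∀ k → F (k + d) ≡ - F k
  flip k = inverseʳ-unique (F k) (F (k + d)) (F-anti k)
  period-2d : Periodic (d + d) F
  period-2d k = begin
    F (k + (d + d))   ≡⟨ cong F (ℕP.+-assoc k d d) ⟨
    F (k + d + d)     ≡⟨ flip (k + d) ⟩
    - F (k + d)       ≡⟨ cong -_ (flip k) ⟩
    - - F k           ≡⟨ ⁻¹-involutive (F k) ⟩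
    F k               ∎
  q = o / 2
  o*d≡d+q*2d : o * d ≡ d + q * (d + d)
  o*d≡d+q*2d = begin
    o * d                 ≡⟨ cong (_* d) (m≡m%n+[m/n]*n o 2) ⟩
    (o % 2 + q * 2) * d   ≡⟨ cong (λ r → (r + q * 2) * d) o%2≡1 ⟩
    (1 + q * 2) * d       ≡⟨ odd-times q d ⟩
    d + q * (d + d)       ∎
    where
    odd-times : ∀ q d → (1 + q * 2) * d ≡ d + q * (d + d)
    odd-times = ℕ-Solver.solve-∀
  F-d-periodic : F (k + d) ≡ F k
  F-d-periodic = begin
    F (k + d)                     ≡⟨ periodic-* period-2d (k + d) q ⟨
    F (k + d + q * (d + d))       ≡⟨ cong F (ℕP.+-assoc k d (q * (d + d))) ⟩
    F (k + (d + q * (d + d)))     ≡⟨ cong (λ r → F (k + r)) (trans (sym o*d≡d+q*2d) od≡tm) ⟩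
    F (k + t * m)                 ≡⟨ periodic-* per k t ⟩
    F k                           ∎

triple-kernel⇒alternating :
  ∀ {m a b d o X} .{{_ : NonZero m}} →
  sgn m ≡ 1ℚ → sgn a ≡ -1ℚ → sgn b ≡ -1ℚ → gcd m a ≡ 1 → gcd m b ≡ 1 → m ∣ o * d → o % 2 ≡ 1 →
  Periodic m X → (∀ k → 1+T^ d (1+T^ a (1+T^ b X)) k ≡ 0ℚ) → ∀ k → X k ≡ X 0 *ℚ sgn k
triple-kernel⇒alternating {m} {a} {b} {d} {o} {X} m-even a-odd b-odd gcd-a gcd-b m∣od o-odd per ΦX≡0 =
  antiperiodic⇒alternating m-even b-odd gcd-b per f≡0
  where
  f = 1+T^ b X
  f-periodic : Periodic m f
  f-periodic = 1+T^-periodic b per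
  f-alternating : ∀ k → f k ≡ f 0 *ℚ sgn k
  f-alternating = antiperiodic⇒alternating m-even a-odd gcd-a f-periodic
    (oddMultiple-antiperiodic⇒0 {o = o} m∣od o-odd (1+T^-periodic a f-periodic) ΦX≡0)
  f≡0 : ∀ k → f k ≡ 0ℚ
  f≡0 k = begin
    f k                ≡⟨ f-alternating k ⟩
    f 0 *ℚ sgn k       ≡⟨ cong (_*ℚ sgn k) (alternating-drift⇒0 (f 0) m-even b-odd per f-alternating) ⟩
    0ℚ *ℚ sgn k        ≡⟨ ℚP.*-zeroˡ (sgn k) ⟩
    0ℚ                 ∎
    where open ≡-Reasoning

-- rowX X Y i and rowY X Y j are the entries at x_i and y_j of B₃ applied to the vector with parts
-- X and Y, where h = m / 2, a′ = m − a, b′ = m − b and d = b − a.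
module KernelEquations (m h a b d a′ b′ : ℕ)
  (h+h≡m : h + h ≡ m) (a+a′≡m : a + a′ ≡ m) (b+b′≡m : b + b′ ≡ m) (a+d≡b : a + d ≡ b) where

  r : ℕ
  r = h + b′

  -- Φ = Tᵇ (P P⁎ − 1) for P = 1 + Tᵃ + Tᵇ and its adjoint P⁎ = 1 + T⁻ᵃ + T⁻ᵇ.
  Φ : (ℕ → ℚ) → ℕ → ℚ
  Φ X = 1+T^ d (1+T^ a (1+T^ b X))

  -- The y-rows solved for Y; as r ≡ h − b (mod m), the three values are X at j + h − b, j + h − a, j + h.
  companion : (ℕ → ℚ) → ℕ → ℚ
  companion X j = - (X (j + r) +ℚ (X (j + r + d) +ℚ X (j + r + b)))

  rowX rowY : (X Y : ℕ → ℚ) → ℕ → ℚ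
  rowX X Y i = X (i + h) +ℚ (Y i +ℚ (Y (i + a) +ℚ Y (i + b)))
  rowY X Y j = (X j +ℚ (X (j + a′) +ℚ X (j + b′))) +ℚ Y (j + h)

  rowX-periodic : ∀ {X Y} → Periodic m X → Periodic m Y → Periodic m (rowX X Y)
  rowX-periodic per-X per-Y i = cong₂ _+ℚ_ (periodic-shift h per-X i)
    (cong₂ _+ℚ_ (per-Y i) (cong₂ _+ℚ_ (periodic-shift a per-Y i) (periodic-shift b per-Y i)))

  rowY-periodic : ∀ {X Y} → Periodic m X → Periodic m Y → Periodic m (rowY X Y)
  rowY-periodic per-X per-Y j = cong₂ _+ℚ_
    (cong₂ _+ℚ_ (per-X j) (cong₂ _+ℚ_ (periodic-shift a′ per-X j) (periodic-shift b′ per-X j)))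
    (periodic-shift h per-Y j)

  rowX-congʳ : ∀ {X Y Y′} → (∀ k → Y k ≡ Y′ k) → ∀ i → rowX X Y i ≡ rowX X Y′ i
  rowX-congʳ {X} Y≗Y′ i =
    cong (X (i + h) +ℚ_) (cong₂ _+ℚ_ (Y≗Y′ i) (cong₂ _+ℚ_ (Y≗Y′ (i + a)) (Y≗Y′ (i + b))))

  X[i+h]≡X[i+r+b] : ∀ {X} → Periodic m X → ∀ i → X (i + h) ≡ X (i + r + b)
  X[i+h]≡X[i+r+b] {X} per i = sym (begin
    X (i + (h + b′) + b)   ≡⟨ cong X (ℕ-Solver.solve (i ∷ h ∷ b′ ∷ b ∷ [])) ⟩
    X (i + h + (b + b′))   ≡⟨ cong (λ t → X (i + h + t)) b+b′≡m ⟩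
    X (i + h + m)          ≡⟨ per (i + h) ⟩
    X (i + h)              ∎)
    where open ≡-Reasoning

  periodic-h+h : ∀ {F} → Periodic m F → ∀ k → F (k + h + h) ≡ F k
  periodic-h+h {F} per k = trans (cong F (trans (ℕP.+-assoc k h h) (cong (k +_) h+h≡m))) (per k)

  -- Up to a period, each value of X on the left is one of the eight values making up Φ X (i + r).
  rowX-companion : ∀ {X} → Periodic m X → ∀ i →
    rowX X (companion X) i ≡ - Φ X (i + r)
  rowX-companion {X} per i =
    regroup (X (i + r)) (X (i + r + d)) (X[i+h]≡X[i+r+b] per i) a≡ ad≡ ab≡ b≡ bd≡ bb≡
    where
    open ≡-Reasoning
    a≡ : X (i + a + (h + b′)) ≡ X (i + (h + b′) + a)
    a≡ = cong X (ℕ-Solver.solve (i ∷ a ∷ h ∷ b′ ∷ []))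
    ad≡ : X (i + a + (h + b′) + d) ≡ X (i + (h + b′) + d + a)
    ad≡ = cong X (ℕ-Solver.solve (i ∷ a ∷ h ∷ b′ ∷ d ∷ []))
    ab≡ : X (i + a + (h + b′) + b) ≡ X (i + (h + b′) + a + b)
    ab≡ = cong X (ℕ-Solver.solve (i ∷ a ∷ h ∷ b′ ∷ b ∷ []))
    b≡ : X (i + b + (h + b′)) ≡ X (i + (h + b′) + b)
    b≡ = cong X (ℕ-Solver.solve (i ∷ b ∷ h ∷ b′ ∷ []))
    bd≡ : X (i + b + (h + b′) + d) ≡ X (i + (h + b′) + d + b)
    bd≡ = cong X (ℕ-Solver.solve (i ∷ b ∷ h ∷ b′ ∷ d ∷ []))
    bb≡ : X (i + b + (h + b′) + b) ≡ X (i + (h + b′) + d + a + b)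
    bb≡ = begin
      X (i + b + (h + b′) + b)         ≡⟨ cong (λ t → X (i + t + (h + b′) + b)) a+d≡b ⟨
      X (i + (a + d) + (h + b′) + b)   ≡⟨ cong X (ℕ-Solver.solve (i ∷ a ∷ d ∷ h ∷ b′ ∷ b ∷ [])) ⟩
      X (i + (h + b′) + d + a + b)     ∎
    ring-identity : ∀ p₀ p₁ p₂ p₃ p₄ p₅ p₆ p₇ →
      p₁ +ℚ (- (p₀ +ℚ (p₄ +ℚ p₁)) +ℚ (- (p₂ +ℚ (p₆ +ℚ p₃)) +ℚ - (p₁ +ℚ (p₅ +ℚ p₇)))) ≡
      - (((p₀ +ℚ p₁) +ℚ (p₂ +ℚ p₃)) +ℚ ((p₄ +ℚ p₅) +ℚ (p₆ +ℚ p₇)))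
    ring-identity = solve-∀ ℚ-ring
    regroup : ∀ p₀ p₄ {x p₁ p₂ p₃ p₅ p₆ p₇ y₁ y₂ y₃ y₄ y₅ y₆} →
      x ≡ p₁ → y₁ ≡ p₂ → y₂ ≡ p₆ → y₃ ≡ p₃ → y₄ ≡ p₁ → y₅ ≡ p₅ → y₆ ≡ p₇ →
      x +ℚ (- (p₀ +ℚ (p₄ +ℚ p₁)) +ℚ (- (y₁ +ℚ (y₂ +ℚ y₃)) +ℚ - (y₄ +ℚ (y₅ +ℚ y₆)))) ≡
      - (((p₀ +ℚ p₁) +ℚ (p₂ +ℚ p₃)) +ℚ ((p₄ +ℚ p₅) +ℚ (p₆ +ℚ p₇)))
    regroup p₀ p₄ {p₁ = p₁} {p₂} {p₃} {p₅} {p₆} {p₇} refl refl refl refl refl refl refl =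
      ring-identity p₀ p₁ p₂ p₃ p₄ p₅ p₆ p₇

  Φ-periodic : ∀ {X} → Periodic m X → Periodic m (Φ X)
  Φ-periodic per = 1+T^-periodic d (1+T^-periodic a (1+T^-periodic b per))

  Φ≡0⇒rowX-companion : ∀ {X} → Periodic m X → (∀ k → Φ X k ≡ 0ℚ) → ∀ i → rowX X (companion X) i ≡ 0ℚ
  Φ≡0⇒rowX-companion per Φ≡0 i = trans (rowX-companion per i) (cong -_ (Φ≡0 (i + r)))

  rowX-companion⇒Φ≡0 : ∀ {X} → Periodic m X → (∀ i → rowX X (companion X) i ≡ 0ℚ) → ∀ k → Φ X k ≡ 0ℚ
  rowX-companion⇒Φ≡0 {X} per row k = begin
    Φ X k                      ≡⟨ periodic-* (Φ-periodic per) k 2 ⟨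
    Φ X (k + 2 * m)            ≡⟨ cong (Φ X) k+2m≡i+r ⟩
    Φ X (i + r)                ≡⟨ ⁻¹-involutive (Φ X (i + r)) ⟨
    - (- Φ X (i + r))          ≡⟨ cong -_ (trans (sym (rowX-companion per i)) (row i)) ⟩
    - 0ℚ                       ≡⟨⟩
    0ℚ                         ∎
    where
    open ≡-Reasoning
    i = k + b + h
    k+2m≡i+r : k + 2 * m ≡ k + b + h + (h + b′)
    k+2m≡i+r = begin
      k + 2 * m                   ≡⟨ ℕ-Solver.solve (k ∷ m ∷ []) ⟩
      k + m + m                   ≡⟨ cong₂ (λ s t → k + s + t) b+b′≡m h+h≡m ⟨
      k + (b + b′) + (h + h)      ≡⟨ ℕ-Solver.solve (k ∷ b ∷ b′ ∷ h ∷ []) ⟩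
      k + b + h + (h + b′)        ∎


  a′≡d+b′ : a′ ≡ d + b′
  a′≡d+b′ = ℕP.+-cancelˡ-≡ a a′ (d + b′) (begin
    a + a′         ≡⟨ a+a′≡m ⟩
    m              ≡⟨ b+b′≡m ⟨
    b + b′         ≡⟨ cong (_+ b′) a+d≡b ⟨
    a + d + b′     ≡⟨ ℕP.+-assoc a d b′ ⟩
    a + (d + b′)   ∎)
    where open ≡-Reasoning

  rowY-companion : ∀ {X} → Periodic m X → ∀ j →
    (X (j + h) +ℚ (X (j + h + a′) +ℚ X (j + h + b′))) +ℚ companion X j ≡ 0ℚ
  rowY-companion {X} per j = begin
    (X (j + h) +ℚ (X (j + h + a′) +ℚ X (j + h + b′))) +ℚ companion X j
      ≡⟨ cong (λ x → (x +ℚ (X (j + h + a′) +ℚ X (j + h + b′))) +ℚ companion X j) (X[i+h]≡X[i+r+b] per j) ⟩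
    (X (j + r + b) +ℚ (X (j + h + a′) +ℚ X (j + h + b′))) +ℚ companion X j
      ≡⟨ cong₂ (λ y z → (X (j + r + b) +ℚ (y +ℚ z)) +ℚ companion X j)
               a′≈r+d (cong X (ℕP.+-assoc j h b′)) ⟩
    (X (j + r + b) +ℚ (X (j + r + d) +ℚ X (j + r))) +ℚ companion X j
      ≡⟨ cancel (X (j + r + b)) (X (j + r + d)) (X (j + r)) ⟩
    0ℚ ∎
    where
    open ≡-Reasoning
    a′≈r+d : X (j + h + a′) ≡ X (j + (h + b′) + d)
    a′≈r+d = cong X (begin
      j + h + a′         ≡⟨ cong (j + h +_) a′≡d+b′ ⟩
      j + h + (d + b′)   ≡⟨ ℕ-Solver.solve (j ∷ h ∷ d ∷ b′ ∷ []) ⟩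
      j + (h + b′) + d   ∎)
    cancel : ∀ x y z → (x +ℚ (y +ℚ z)) +ℚ - (z +ℚ (y +ℚ x)) ≡ 0ℚ
    cancel = solve-∀ ℚ-ring

  rowY⇒companion : ∀ {X Y} → Periodic m X → Periodic m Y → (∀ j → rowY X Y j ≡ 0ℚ) →
                   ∀ j → Y j ≡ companion X j
  rowY⇒companion {X} {Y} per-X per-Y row j = begin
    Y j                 ≡⟨ periodic-h+h per-Y j ⟨
    Y (j + h + h)       ≡⟨ inverseʳ-unique _ _ (row (j + h)) ⟩
    - A                 ≡⟨ inverseʳ-unique A _ (rowY-companion per-X j) ⟨
    companion X j       ∎
    where
    open ≡-Reasoning
    A = X (j + h) +ℚ (X (j + h + a′) +ℚ X (j + h + b′))

  companion-periodic : ∀ {X} → Periodic m X → Periodic m (companion X)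
  companion-periodic per k = cong -_ (cong₂ _+ℚ_ (periodic-shift r per k)
    (cong₂ _+ℚ_ (periodic-shift r (periodic-shift d per) k) (periodic-shift r (periodic-shift b per) k)))

  companion⇒rowY : ∀ {X} → Periodic m X → ∀ j → rowY X (companion X) j ≡ 0ℚ
  companion⇒rowY {X} per j =
    trans (cong (_+ℚ companion X (j + h)) (sym (periodic-h+h A-periodic j))) (rowY-companion per (j + h))
    where
    A-periodic : Periodic m (λ k → X k +ℚ (X (k + a′) +ℚ X (k + b′)))
    A-periodic k = cong₂ _+ℚ_ (per k) (cong₂ _+ℚ_ (periodic-shift a′ per k) (periodic-shift b′ per k))

  Φ-killed-by-b : ∀ Q → (∀ k → 1+T^ b Q k ≡ 0ℚ) → ∀ k → Φ Q k ≡ 0ℚ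
  Φ-killed-by-b Q b≡0 = 1+T^-zero d (1+T^-zero a b≡0)

  Φ-killed-by-a : ∀ Q → (∀ k → 1+T^ a Q k ≡ 0ℚ) → ∀ k → Φ Q k ≡ 0ℚ
  Φ-killed-by-a Q a≡0 k =
    trans (1+T^-cong d (1+T^-comm a b Q) k) (1+T^-zero d (1+T^-zero b a≡0) k)

  Φ-killed-by-d : ∀ Q → (∀ k → 1+T^ d Q k ≡ 0ℚ) → ∀ k → Φ Q k ≡ 0ℚ
  Φ-killed-by-d Q d≡0 k = begin
    1+T^ d (1+T^ a (1+T^ b Q)) k     ≡⟨ 1+T^-comm d a (1+T^ b Q) k ⟩
    1+T^ a (1+T^ d (1+T^ b Q)) k     ≡⟨ 1+T^-cong a (1+T^-comm d b Q) k ⟩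
    1+T^ a (1+T^ b (1+T^ d Q)) k     ≡⟨ 1+T^-zero a (1+T^-zero b d≡0) k ⟩
    0ℚ                               ∎
    where open ≡-Reasoning

  Φ-alternate : sgn a ≡ 1ℚ → sgn b ≡ 1ℚ → sgn d ≡ 1ℚ → ∀ X k → Φ (alternate X) k ≡ alternate (Φ X) k
  Φ-alternate a-even b-even d-even X k = begin
    1+T^ d (1+T^ a (1+T^ b (alternate X))) k
      ≡⟨ 1+T^-cong d (1+T^-cong a (1+T^-alternate-even b-even X)) k ⟩
    1+T^ d (1+T^ a (alternate (1+T^ b X))) k
      ≡⟨ 1+T^-cong d (1+T^-alternate-even a-even (1+T^ b X)) k ⟩
    1+T^ d (alternate (1+T^ a (1+T^ b X))) k
      ≡⟨ 1+T^-alternate-even d-even (1+T^ a (1+T^ b X)) k ⟩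
    alternate (Φ X) k ∎
    where open ≡-Reasoning

  companion-linear : ∀ {X X′} c → (∀ k → X k ≡ c *ℚ X′ k) → ∀ j → companion X j ≡ c *ℚ companion X′ j
  companion-linear {X} {X′} c X≗cX′ j = begin
    - (X (j + r) +ℚ (X (j + r + d) +ℚ X (j + r + b)))
      ≡⟨ cong -_ (cong₂ _+ℚ_ (X≗cX′ (j + r)) (cong₂ _+ℚ_ (X≗cX′ (j + r + d)) (X≗cX′ (j + r + b)))) ⟩
    - (c *ℚ X′ (j + r) +ℚ (c *ℚ X′ (j + r + d) +ℚ c *ℚ X′ (j + r + b)))
      ≡⟨ factor c (X′ (j + r)) (X′ (j + r + d)) (X′ (j + r + b)) ⟩
    c *ℚ - (X′ (j + r) +ℚ (X′ (j + r + d) +ℚ X′ (j + r + b))) ∎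
    where
    open ≡-Reasoning
    factor : ∀ c x y z → - (c *ℚ x +ℚ (c *ℚ y +ℚ c *ℚ z)) ≡ c *ℚ - (x +ℚ (y +ℚ z))
    factor = solve-∀ ℚ-ring

ind : Bool → ℚ
ind b = if b then 1ℚ else 0ℚ

ind-∨ : ∀ p q → (T p → T q → ⊥) → ind (p ∨ q) ≡ ind p +ℚ ind q
ind-∨ true  true  excl = ⊥-elim (excl tt tt)
ind-∨ true  false excl = refl
ind-∨ false q     excl = sym (ℚP.+-identityˡ (ind q))

≡ᵇ-cong : ∀ {x y u v} → (x ≡ y → u ≡ v) → (u ≡ v → x ≡ y) → (x ≡ᵇ y) ≡ (u ≡ᵇ v)
≡ᵇ-cong {x} {y} {u} {v} to from with x ≡ᵇ y in e₁ | u ≡ᵇ v in e₂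
... | true  | true  = refl
... | false | false = refl
... | true  | false = ⊥-elim (subst T e₂ (ℕP.≡⇒≡ᵇ u v (to (ℕP.≡ᵇ⇒≡ x y (subst T (sym e₁) tt)))))
... | false | true  = ⊥-elim (subst T e₁ (ℕP.≡⇒≡ᵇ x y (from (ℕP.≡ᵇ⇒≡ u v (subst T (sym e₂) tt)))))

≡ᵇ-unique : ∀ {u x y} → x ≢ y → T (u ≡ᵇ x) → T (u ≡ᵇ y) → ⊥
≡ᵇ-unique {u} {x} {y} x≢y ux uy = x≢y (trans (sym (ℕP.≡ᵇ⇒≡ u x ux)) (ℕP.≡ᵇ⇒≡ u y uy))

distinct-residues : ∀ {m} .{{_ : NonZero m}} x {c} → 0 < c → c < m → (x + c) % m ≢ x % m
distinct-residues {m} x {c} 0<c c<m eq = ℕP.<⇒≱ c<m (∣⇒≤ {{ℕ.>-nonZero 0<c}} m∣c)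
  where
  open ≡-Reasoning
  m∣c : m ∣ c
  m∣c = ∣m+n∣m⇒∣n (divides ((x + c) / m) (ℕP.+-cancelˡ-≡ (x % m) _ _ (begin
    x % m + (x / m * m + c)          ≡⟨ ℕP.+-assoc (x % m) _ c ⟨
    x % m + x / m * m + c            ≡⟨ cong (_+ c) (m≡m%n+[m/n]*n x m) ⟨
    x + c                            ≡⟨ m≡m%n+[m/n]*n (x + c) m ⟩
    (x + c) % m + (x + c) / m * m    ≡⟨ cong (_+ (x + c) / m * m) eq ⟩
    x % m + (x + c) / m * m          ∎))) (n∣m*n (x / m))

[[v+c]%m+c′]%m≡v : ∀ {m} .{{_ : NonZero m}} {v c c′} → v < m → c + c′ ≡ m → ((v + c) % m + c′) % m ≡ v
[[v+c]%m+c′]%m≡v {m} {v} {c} {c′} v<m c+c′≡m = begin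
  ((v + c) % m + c′) % m           ≡⟨ %-distribˡ-+ ((v + c) % m) c′ m ⟩
  ((v + c) % m % m + c′ % m) % m   ≡⟨ cong (λ t → (t + c′ % m) % m) (m%n%n≡m%n (v + c) m) ⟩
  ((v + c) % m + c′ % m) % m       ≡⟨ %-distribˡ-+ (v + c) c′ m ⟨
  (v + c + c′) % m                 ≡⟨ cong (_% m) (trans (ℕP.+-assoc v c c′) (cong (v +_) c+c′≡m)) ⟩
  (v + m) % m                      ≡⟨ [m+n]%n≡m%n v m ⟩
  v % m                            ≡⟨ m<n⇒m%n≡m v<m ⟩
  v                                ∎
  where open ≡-Reasoning

≡ᵇ-flip : ∀ {m} .{{_ : NonZero m}} {u v c c′} → u < m → v < m → c + c′ ≡ m →
          (u ≡ᵇ (v + c) % m) ≡ (v ≡ᵇ (u + c′) % m)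
≡ᵇ-flip {m} {u} {v} {c} {c′} u<m v<m c+c′≡m = ≡ᵇ-cong
  (λ u≡ → sym (trans (cong (λ t → (t + c′) % m) u≡) ([[v+c]%m+c′]%m≡v v<m c+c′≡m)))
  (λ v≡ → sym (trans (cong (λ t → (t + c) % m) v≡) ([[v+c]%m+c′]%m≡v u<m (trans (ℕP.+-comm c′ c) c+c′≡m))))

sumFin≡sum : ∀ n (f : Fin n → ℚ) → sumFin n f ≡ sum f
sumFin≡sum zero    f = refl
sumFin≡sum (suc n) f = cong (f Fin.zero +ℚ_) (sumFin≡sum n (λ i → f (Fin.suc i)))

sum-splitAt : ∀ m n (f : Fin (m + n) → ℚ) → sum f ≡ sum (λ i → f (i ↑ˡ n)) +ℚ sum (λ j → f (m ↑ʳ j))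
sum-splitAt zero    n f = sym (ℚP.+-identityˡ (sum f))
sum-splitAt (suc m) n f =
  trans (cong (f Fin.zero +ℚ_) (sum-splitAt m n (λ i → f (Fin.suc i))))
        (sym (ℚP.+-assoc (f Fin.zero) (sum (λ i → f (Fin.suc i ↑ˡ n))) (sum (λ j → f (suc m ↑ʳ j)))))

sum-select : ∀ {n} k (F : ℕ → ℚ) → k < n → sum {n} (λ j → ind (toℕ j ≡ᵇ k) *ℚ F (toℕ j)) ≡ F k
sum-select {suc n} zero F _ = begin
  1ℚ *ℚ F 0 +ℚ sum {n} (λ j → 0ℚ *ℚ F (suc (toℕ j)))
    ≡⟨ cong₂ _+ℚ_ (ℚP.*-identityˡ (F 0)) (sum-cong-≗ {n} (λ j → ℚP.*-zeroˡ (F (suc (toℕ j))))) ⟩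
  F 0 +ℚ sum {n} (λ _ → 0ℚ)      ≡⟨ cong (F 0 +ℚ_) (sum-replicate-zero n) ⟩
  F 0 +ℚ 0ℚ                      ≡⟨ ℚP.+-identityʳ (F 0) ⟩
  F 0                            ∎
  where open ≡-Reasoning
sum-select {suc n} (suc k) F k<n = begin
  0ℚ *ℚ F 0 +ℚ sum {n} (λ j → ind (toℕ j ≡ᵇ k) *ℚ F (suc (toℕ j)))
    ≡⟨ cong₂ _+ℚ_ (ℚP.*-zeroˡ (F 0)) (sum-select k (λ j → F (suc j)) (s≤s⁻¹ k<n)) ⟩
  0ℚ +ℚ F (suc k)                ≡⟨ ℚP.+-identityˡ (F (suc k)) ⟩
  F (suc k)                      ∎
  where open ≡-Reasoning

sum-select-mod : ∀ {m F} .{{_ : NonZero m}} → Periodic m F → ∀ (P : ℕ → Bool) k →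
  (∀ u → u < m → P u ≡ (u ≡ᵇ k % m)) → sum {m} (λ j → ind (P (toℕ j)) *ℚ F (toℕ j)) ≡ F k
sum-select-mod {m} {F} per P k P≡ = begin
  sum {m} (λ j → ind (P (toℕ j)) *ℚ F (toℕ j))
    ≡⟨ sum-cong-≗ {m} (λ j → cong (λ t → ind t *ℚ F (toℕ j)) (P≡ (toℕ j) (FinP.toℕ<n j))) ⟩
  sum {m} (λ j → ind (toℕ j ≡ᵇ k % m) *ℚ F (toℕ j)) ≡⟨ sum-select (k % m) F (m%n<n k m) ⟩
  F (k % m)                                       ≡⟨ periodic-% per k ⟩
  F k                                             ∎
  where open ≡-Reasoning

sum-distrib₃ : ∀ {n} (f g k F : Fin n → ℚ) →
  sum (λ j → (f j +ℚ (g j +ℚ k j)) *ℚ F j) ≡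
  sum (λ j → f j *ℚ F j) +ℚ (sum (λ j → g j *ℚ F j) +ℚ sum (λ j → k j *ℚ F j))
sum-distrib₃ f g k F = begin
  sum (λ j → (f j +ℚ (g j +ℚ k j)) *ℚ F j)
    ≡⟨ sum-cong-≗ (λ j → trans (ℚP.*-distribʳ-+ (F j) (f j) (g j +ℚ k j))
                                (cong (f j *ℚ F j +ℚ_) (ℚP.*-distribʳ-+ (F j) (g j) (k j)))) ⟩
  sum (λ j → f j *ℚ F j +ℚ (g j *ℚ F j +ℚ k j *ℚ F j))
    ≡⟨ ∑-distrib-+ (λ j → f j *ℚ F j) _ ⟩
  sum (λ j → f j *ℚ F j) +ℚ sum (λ j → g j *ℚ F j +ℚ k j *ℚ F j)
    ≡⟨ cong (sum (λ j → f j *ℚ F j) +ℚ_) (∑-distrib-+ (λ j → g j *ℚ F j) _) ⟩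
  sum (λ j → f j *ℚ F j) +ℚ (sum (λ j → g j *ℚ F j) +ℚ sum (λ j → k j *ℚ F j)) ∎
  where open ≡-Reasoning

↑-cases : ∀ {m n} {P : Fin (m + n) → Set} → (∀ i → P (i ↑ˡ n)) → (∀ j → P (m ↑ʳ j)) → ∀ u → P u
↑-cases {m} {n} {P} left right u with splitAt m u in eq
... | inj₁ i = subst P (FinP.splitAt⁻¹-↑ˡ eq) (left i)
... | inj₂ j = subst P (FinP.splitAt⁻¹-↑ʳ eq) (right j)

module B3Kernel (m a b : ℕ) .{{_ : NonZero m}} (2∣m : 2 ∣ m) (0<a : 0 < a) (a<b : a < b) (b<m : b < m) where

  h a′ b′ : ℕ
  h  = m / 2
  a′ = m ∸ a
  b′ = m ∸ b

  a<m : a < m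
  a<m = ℕP.<-trans a<b b<m

  a+a′≡m : a + a′ ≡ m
  a+a′≡m = ℕP.m+[n∸m]≡n (ℕP.<⇒≤ a<m)

  b+b′≡m : b + b′ ≡ m
  b+b′≡m = ℕP.m+[n∸m]≡n (ℕP.<⇒≤ b<m)

  h+h≡m : h + h ≡ m
  h+h≡m = trans (cong (h +_) (sym (ℕP.+-identityʳ h))) (trans (ℕP.*-comm 2 h) (m/n*n≡m 2∣m))

  d : ℕ
  d = b ∸ a

  a+d≡b : a + d ≡ b
  a+d≡b = ℕP.m+[n∸m]≡n (ℕP.<⇒≤ a<b)

  open KernelEquations m h a b d a′ b′ h+h≡m a+a′≡m b+b′≡m a+d≡b public

  -- The first summand is written with v + 0 so that all three have the shape (v + c) % m.
  ind-adjacent : ∀ u v →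
    ind ((u ≡ᵇ v % m) ∨ (u ≡ᵇ (v + a) % m) ∨ (u ≡ᵇ (v + b) % m)) ≡
    ind (u ≡ᵇ (v + 0) % m) +ℚ (ind (u ≡ᵇ (v + a) % m) +ℚ ind (u ≡ᵇ (v + b) % m))
  ind-adjacent u v = begin
    ind ((u ≡ᵇ v % m) ∨ ((u ≡ᵇ (v + a) % m) ∨ (u ≡ᵇ (v + b) % m)))
      ≡⟨ ind-∨ (u ≡ᵇ v % m) ((u ≡ᵇ (v + a) % m) ∨ (u ≡ᵇ (v + b) % m)) excl₀ ⟩
    ind (u ≡ᵇ v % m) +ℚ ind ((u ≡ᵇ (v + a) % m) ∨ (u ≡ᵇ (v + b) % m))
      ≡⟨ cong₂ _+ℚ_ (cong (λ t → ind (u ≡ᵇ t % m)) (sym (ℕP.+-identityʳ v)))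
                    (ind-∨ (u ≡ᵇ (v + a) % m) (u ≡ᵇ (v + b) % m) (≡ᵇ-unique {u} a≢b)) ⟩
    ind (u ≡ᵇ (v + 0) % m) +ℚ (ind (u ≡ᵇ (v + a) % m) +ℚ ind (u ≡ᵇ (v + b) % m)) ∎
    where
    open ≡-Reasoning
    0≢a : v % m ≢ (v + a) % m
    0≢a e = distinct-residues v 0<a a<m (sym e)
    0≢b : v % m ≢ (v + b) % m
    0≢b e = distinct-residues v (ℕP.<-trans 0<a a<b) b<m (sym e)
    a≢b : (v + a) % m ≢ (v + b) % m
    a≢b e = distinct-residues (v + a) (ℕP.m<n⇒0<n∸m a<b) (ℕP.≤-<-trans (ℕP.m∸n≤m b a) b<m)
      (trans (cong (_% m) (trans (ℕP.+-assoc v a d) (cong (v +_) a+d≡b))) (sym e))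
    excl₀ : T (u ≡ᵇ v % m) → T ((u ≡ᵇ (v + a) % m) ∨ (u ≡ᵇ (v + b) % m)) → ⊥
    excl₀ t₀ t₁ with Equivalence.to T-∨ t₁
    ... | inj₁ tₐ = ≡ᵇ-unique {u} 0≢a t₀ tₐ
    ... | inj₂ t_b = ≡ᵇ-unique {u} 0≢b t₀ t_b

  B3-entry : ∀ {u v p q} → splitAt m u ≡ p → splitAt m v ≡ q → B3 m a b u v ≡ ind (adjB3 m a b p q)
  B3-entry refl refl = refl

  module Rows {z : Fin (m + m) → ℚ} {X Y : ℕ → ℚ} (per-X : Periodic m X) (per-Y : Periodic m Y)
              (z-x : ∀ i → z (i ↑ˡ m) ≡ X (toℕ i)) (z-y : ∀ j → z (m ↑ʳ j) ≡ Y (toℕ j)) where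

    split-row : ∀ u → (B3 m a b · z) u ≡
      sum (λ j → B3 m a b u (j ↑ˡ m) *ℚ z (j ↑ˡ m)) +ℚ sum (λ j → B3 m a b u (m ↑ʳ j) *ℚ z (m ↑ʳ j))
    split-row u = trans (sumFin≡sum (m + m) _) (sum-splitAt m m _)

    row-x : ∀ i → (B3 m a b · z) (i ↑ˡ m) ≡ rowX X Y (toℕ i)
    row-x i = trans (split-row (i ↑ˡ m)) (cong₂ _+ℚ_ x-part y-part)
      where
      open ≡-Reasoning
      I = toℕ i
      x-part : sum (λ j → B3 m a b (i ↑ˡ m) (j ↑ˡ m) *ℚ z (j ↑ˡ m)) ≡ X (I + h)
      x-part = trans
        (sum-cong-≗ {m} (λ j → cong₂ _*ℚ_ (B3-entry (FinP.splitAt-↑ˡ m i m) (FinP.splitAt-↑ˡ m j m)) (z-x j)))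
        (sum-select-mod per-X _ (I + h) (λ _ _ → refl))
      select : ∀ c → sum {m} (λ j → ind (toℕ j ≡ᵇ (I + c) % m) *ℚ Y (toℕ j)) ≡ Y (I + c)
      select c = sum-select-mod per-Y _ (I + c) (λ _ _ → refl)
      y-part : sum (λ j → B3 m a b (i ↑ˡ m) (m ↑ʳ j) *ℚ z (m ↑ʳ j)) ≡ Y I +ℚ (Y (I + a) +ℚ Y (I + b))
      y-part = begin
        sum {m} (λ j → B3 m a b (i ↑ˡ m) (m ↑ʳ j) *ℚ z (m ↑ʳ j))
          ≡⟨ sum-cong-≗ {m} (λ j → cong₂ _*ℚ_
               (trans (B3-entry (FinP.splitAt-↑ˡ m i m) (FinP.splitAt-↑ʳ m m j)) (ind-adjacent (toℕ j) I)) (z-y j)) ⟩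
        sum {m} (λ j → (ind (toℕ j ≡ᵇ (I + 0) % m) +ℚ
                        (ind (toℕ j ≡ᵇ (I + a) % m) +ℚ ind (toℕ j ≡ᵇ (I + b) % m))) *ℚ Y (toℕ j))
          ≡⟨ sum-distrib₃ {m} (λ j → ind (toℕ j ≡ᵇ (I + 0) % m)) (λ j → ind (toℕ j ≡ᵇ (I + a) % m))
                          (λ j → ind (toℕ j ≡ᵇ (I + b) % m)) (λ j → Y (toℕ j)) ⟩
        sum {m} (λ j → ind (toℕ j ≡ᵇ (I + 0) % m) *ℚ Y (toℕ j)) +ℚ
          (sum {m} (λ j → ind (toℕ j ≡ᵇ (I + a) % m) *ℚ Y (toℕ j)) +ℚ
           sum {m} (λ j → ind (toℕ j ≡ᵇ (I + b) % m) *ℚ Y (toℕ j)))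
          ≡⟨ cong₂ _+ℚ_ (select 0) (cong₂ _+ℚ_ (select a) (select b)) ⟩
        Y (I + 0) +ℚ (Y (I + a) +ℚ Y (I + b))
          ≡⟨ cong (λ t → Y t +ℚ (Y (I + a) +ℚ Y (I + b))) (ℕP.+-identityʳ I) ⟩
        Y I +ℚ (Y (I + a) +ℚ Y (I + b)) ∎

    row-y : ∀ j → (B3 m a b · z) (m ↑ʳ j) ≡ rowY X Y (toℕ j)
    row-y j = trans (split-row (m ↑ʳ j)) (cong₂ _+ℚ_ x-part y-part)
      where
      open ≡-Reasoning
      J = toℕ j
      y-part : sum (λ i → B3 m a b (m ↑ʳ j) (m ↑ʳ i) *ℚ z (m ↑ʳ i)) ≡ Y (J + h)
      y-part = trans
        (sum-cong-≗ {m} (λ i → cong₂ _*ℚ_ (B3-entry (FinP.splitAt-↑ʳ m m j) (FinP.splitAt-↑ʳ m m i)) (z-y i)))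
        (sum-select-mod per-Y _ (J + h) (λ _ _ → refl))
      select : ∀ c c′ → c + c′ ≡ m →
               sum {m} (λ i → ind (J ≡ᵇ (toℕ i + c) % m) *ℚ X (toℕ i)) ≡ X (J + c′)
      select c c′ c+c′≡m =
        sum-select-mod per-X _ (J + c′) (λ u u<m → ≡ᵇ-flip (FinP.toℕ<n j) u<m c+c′≡m)
      x-part : sum (λ i → B3 m a b (m ↑ʳ j) (i ↑ˡ m) *ℚ z (i ↑ˡ m)) ≡ X J +ℚ (X (J + a′) +ℚ X (J + b′))
      x-part = begin
        sum {m} (λ i → B3 m a b (m ↑ʳ j) (i ↑ˡ m) *ℚ z (i ↑ˡ m))
          ≡⟨ sum-cong-≗ {m} (λ i → cong₂ _*ℚ_
               (trans (B3-entry (FinP.splitAt-↑ʳ m m j) (FinP.splitAt-↑ˡ m i m)) (ind-adjacent J (toℕ i))) (z-x i)) ⟩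
        sum {m} (λ i → (ind (J ≡ᵇ (toℕ i + 0) % m) +ℚ
                        (ind (J ≡ᵇ (toℕ i + a) % m) +ℚ ind (J ≡ᵇ (toℕ i + b) % m))) *ℚ X (toℕ i))
          ≡⟨ sum-distrib₃ {m} (λ i → ind (J ≡ᵇ (toℕ i + 0) % m)) (λ i → ind (J ≡ᵇ (toℕ i + a) % m))
                          (λ i → ind (J ≡ᵇ (toℕ i + b) % m)) (λ i → X (toℕ i)) ⟩
        sum {m} (λ i → ind (J ≡ᵇ (toℕ i + 0) % m) *ℚ X (toℕ i)) +ℚ
          (sum {m} (λ i → ind (J ≡ᵇ (toℕ i + a) % m) *ℚ X (toℕ i)) +ℚ
           sum {m} (λ i → ind (J ≡ᵇ (toℕ i + b) % m) *ℚ X (toℕ i)))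
          ≡⟨ cong₂ _+ℚ_ (select 0 m refl) (cong₂ _+ℚ_ (select a a′ a+a′≡m) (select b b′ b+b′≡m)) ⟩
        X (J + m) +ℚ (X (J + a′) +ℚ X (J + b′))
          ≡⟨ cong (_+ℚ (X (J + a′) +ℚ X (J + b′))) (per-X J) ⟩
        X J +ℚ (X (J + a′) +ℚ X (J + b′)) ∎


    InKernel⇒rows : InKernel (B3 m a b) z → (∀ i → rowX X Y i ≡ 0ℚ) × (∀ j → rowY X Y j ≡ 0ℚ)
    InKernel⇒rows kernel = via-residue (rowX-periodic per-X per-Y) (λ i → trans (sym (row-x i)) (kernel (i ↑ˡ m)))
                         , via-residue (rowY-periodic per-X per-Y) (λ j → trans (sym (row-y j)) (kernel (m ↑ʳ j)))
      where
      via-residue : ∀ {F} → Periodic m F → (∀ (i : Fin m) → F (toℕ i) ≡ 0ℚ) → ∀ k → F k ≡ 0ℚ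
      via-residue {F} per F≡0 k = begin
        F k                  ≡⟨ periodic-% per k ⟨
        F (k % m)            ≡⟨ cong F (FinP.toℕ-fromℕ< (m%n<n k m)) ⟨
        F (toℕ (k mod m))    ≡⟨ F≡0 (k mod m) ⟩
        0ℚ                   ∎
        where open ≡-Reasoning

    rows⇒InKernel : (∀ i → rowX X Y i ≡ 0ℚ) → (∀ j → rowY X Y j ≡ 0ℚ) → InKernel (B3 m a b) z
    rows⇒InKernel rowX≡0 rowY≡0 = ↑-cases (λ i → trans (row-x i) (rowX≡0 (toℕ i)))
                                            (λ j → trans (row-y j) (rowY≡0 (toℕ j)))

  xPart yPart : (Fin (m + m) → ℚ) → ℕ → ℚ
  xPart z k = z ((k mod m) ↑ˡ m)
  yPart z k = z (m ↑ʳ (k mod m))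

  fromParts : (ℕ → ℚ) → (ℕ → ℚ) → Fin (m + m) → ℚ
  fromParts X Y u = [ X ∘ toℕ , Y ∘ toℕ ]′ (splitAt m u)

  fromParts-x : ∀ X Y i → fromParts X Y (i ↑ˡ m) ≡ X (toℕ i)
  fromParts-x X Y i = cong [ X ∘ toℕ , Y ∘ toℕ ]′ (FinP.splitAt-↑ˡ m i m)

  fromParts-y : ∀ X Y j → fromParts X Y (m ↑ʳ j) ≡ Y (toℕ j)
  fromParts-y X Y j = cong [ X ∘ toℕ , Y ∘ toℕ ]′ (FinP.splitAt-↑ʳ m m j)

  mod-periodic : ∀ k → (k + m) mod m ≡ k mod m
  mod-periodic k = FinP.fromℕ<-cong _ _ ([m+n]%n≡m%n k m) _ _

  toℕ-mod : ∀ (j : Fin m) → toℕ j mod m ≡ j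
  toℕ-mod j = FinP.toℕ-injective (trans (FinP.toℕ-fromℕ< _) (m<n⇒m%n≡m (FinP.toℕ<n j)))

  xPart-↑ˡ : ∀ z i → xPart z (toℕ i) ≡ z (i ↑ˡ m)
  xPart-↑ˡ z i = cong (λ t → z (t ↑ˡ m)) (toℕ-mod i)

  yPart-↑ʳ : ∀ z j → yPart z (toℕ j) ≡ z (m ↑ʳ j)
  yPart-↑ʳ z j = cong (λ t → z (m ↑ʳ t)) (toℕ-mod j)

  xPart-periodic : ∀ z → Periodic m (xPart z)
  xPart-periodic z k = cong (λ i → z (i ↑ˡ m)) (mod-periodic k)

  yPart-periodic : ∀ z → Periodic m (yPart z)
  yPart-periodic z k = cong (λ j → z (m ↑ʳ j)) (mod-periodic k)

  kernel⇒Φ : ∀ {z} → InKernel (B3 m a b) z →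
             (∀ k → Φ (xPart z) k ≡ 0ℚ) × (∀ k → yPart z k ≡ companion (xPart z) k)
  kernel⇒Φ {z} kernel =
    rowX-companion⇒Φ≡0 per-X (λ i → trans (sym (rowX-congʳ {xPart z} Y≗C i)) (rowX≡0 i)) , Y≗C
    where
    per-X = xPart-periodic z
    per-Y = yPart-periodic z
    rows = Rows.InKernel⇒rows per-X per-Y (λ i → sym (xPart-↑ˡ z i)) (λ j → sym (yPart-↑ʳ z j)) kernel
    rowX≡0 = proj₁ rows
    Y≗C = rowY⇒companion per-X per-Y (proj₂ rows)

  Φ⇒kernel : ∀ {X} → Periodic m X → (∀ k → Φ X k ≡ 0ℚ) → InKernel (B3 m a b) (fromParts X (companion X))
  Φ⇒kernel {X} per Φ≡0 = Rows.rows⇒InKernel per (companion-periodic per) (fromParts-x X (companion X))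
    (fromParts-y X (companion X)) (Φ≡0⇒rowX-companion per Φ≡0) (companion⇒rowY per)

module TestVector (t : ℕ) .{{_ : NonZero t}} where

  Q : ℕ → ℚ
  Q k = if k % t ≡ᵇ 0 then sgn (k / t) else 0ℚ

  Q-shift : ∀ k n → Q (k + n * t) ≡ sgn n *ℚ Q k
  Q-shift k n = begin
    (if (k + n * t) % t ≡ᵇ 0 then sgn ((k + n * t) / t) else 0ℚ)
      ≡⟨ cong₂ (λ r q → if r ≡ᵇ 0 then sgn q else 0ℚ) ([m+kn]%n≡m%n k n t) quotient ⟩
    (if k % t ≡ᵇ 0 then sgn (k / t + n) else 0ℚ)
      ≡⟨ branches (k % t ≡ᵇ 0) ⟩
    sgn n *ℚ Q k ∎
    where
    open ≡-Reasoning
    quotient : (k + n * t) / t ≡ k / t + n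
    quotient = trans (+-distrib-/-∣ʳ k (n∣m*n n)) (cong (k / t +_) (m*n/n≡m n t))
    branches : ∀ bit → (if bit then sgn (k / t + n) else 0ℚ) ≡ sgn n *ℚ (if bit then sgn (k / t) else 0ℚ)
    branches true  = trans (sgn-+ (k / t) n) (ℚP.*-comm (sgn (k / t)) (sgn n))
    branches false = sym (ℚP.*-zeroʳ (sgn n))

  Q-periodic : ∀ {p} → sgn p ≡ 1ℚ → Periodic (p * t) Q
  Q-periodic {p} p-even k = trans (Q-shift k p) (trans (cong (_*ℚ Q k) p-even) (ℚP.*-identityˡ (Q k)))

  Q-antiperiodic : ∀ {o} → sgn o ≡ -1ℚ → ∀ k → 1+T^ (o * t) Q k ≡ 0ℚ
  Q-antiperiodic {o} o-odd k = begin
    Q k +ℚ Q (k + o * t)      ≡⟨ cong (Q k +ℚ_) (trans (Q-shift k o) (cong (_*ℚ Q k) o-odd)) ⟩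
    Q k +ℚ -1ℚ *ℚ Q k         ≡⟨ cancel (Q k) ⟩
    0ℚ                        ∎
    where
    open ≡-Reasoning
    cancel : ∀ q → q +ℚ -1ℚ *ℚ q ≡ 0ℚ
    cancel = solve-∀ ℚ-ring

  Q-0 : Q 0 ≡ 1ℚ
  Q-0 = cong₂ (λ r q → if r ≡ᵇ 0 then sgn q else 0ℚ) (m<n⇒m%n≡m (ℕ.>-nonZero⁻¹ t)) (0/n≡0 t)

  Q-1 : 2 ≤ t → Q 1 ≡ 0ℚ
  Q-1 2≤t = cong (λ r → if r ≡ᵇ 0 then sgn (1 / t) else 0ℚ) (m<n⇒m%n≡m 2≤t)

≢0∧≢1⇒≥2 : ∀ {n} → n ≢ 0 → n ≢ 1 → 2 ≤ n
≢0∧≢1⇒≥2 {zero}        n≢0 _   = ⊥-elim (n≢0 refl)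
≢0∧≢1⇒≥2 {suc zero}    _   n≢1 = ⊥-elim (n≢1 refl)
≢0∧≢1⇒≥2 {suc (suc n)} _   _   = s≤s (s≤s z≤n)

v2-odd-part : ∀ n → 1 ≤ n → ∃[ o ] n ≡ 2 ^ v2 n * o × o % 2 ≡ 1
v2-odd-part n 1≤n = go n n 1≤n ℕP.≤-refl
  where
  go : ∀ f n → 1 ≤ n → n ≤ f → ∃[ o ] n ≡ 2 ^ v2-fuel f n * o × o % 2 ≡ 1
  go zero    n       1≤n n≤0 = ⊥-elim (ℕP.<-irrefl refl (ℕP.≤-trans 1≤n n≤0))
  go (suc f) (suc k) _   n≤f with parity (suc k)
  ... | inj₂ odd  rewrite odd  = suc k , sym (ℕP.+-identityʳ (suc k)) , odd
  ... | inj₁ even rewrite even = double (go f q 1≤q q≤f)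
    where
    open ≡-Reasoning
    q = suc k / 2
    n≡q*2 : suc k ≡ q * 2
    n≡q*2 = trans (m≡m%n+[m/n]*n (suc k) 2) (cong (_+ q * 2) even)
    1≤q : 1 ≤ q
    1≤q = ℕP.n≢0⇒n>0 (λ q≡0 → ℕP.0≢1+n (sym (trans n≡q*2 (cong (_* 2) q≡0))))
    q≤f : q ≤ f
    q≤f = s≤s⁻¹ (ℕP.<-≤-trans (m/n<m (suc k) 2 (s≤s (s≤s z≤n))) n≤f)
    double : ∃[ o ] q ≡ 2 ^ v2-fuel f q * o × o % 2 ≡ 1 →
             ∃[ o ] suc k ≡ 2 * 2 ^ v2-fuel f q * o × o % 2 ≡ 1
    double (o , q≡ , o-odd) = o , (begin
      suc k                          ≡⟨ n≡q*2 ⟩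
      q * 2                          ≡⟨ cong (_* 2) q≡ ⟩
      2 ^ v2-fuel f q * o * 2        ≡⟨ swap (2 ^ v2-fuel f q) o ⟩
      2 * 2 ^ v2-fuel f q * o        ∎) , o-odd
      where
      swap : ∀ x y → x * y * 2 ≡ 2 * x * y
      swap = ℕ-Solver.solve-∀

-- t divides m with even quotient and c with odd quotient; it yields the test vector TestVector.Q t.
record TestDivisor (m c : ℕ) : Set where
  field
    t      : ℕ
    2≤t    : 2 ≤ t
    p o    : ℕ
    m≡p*t  : m ≡ p * t
    p-even : sgn p ≡ 1ℚ
    c≡o*t  : c ≡ o * t
    o-odd  : sgn o ≡ -1ℚ

gcd≢1⇒testDivisor : ∀ {m c} .{{_ : NonZero m}} → sgn m ≡ 1ℚ → sgn c ≡ -1ℚ → gcd m c ≢ 1 → TestDivisor m c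
gcd≢1⇒testDivisor {m} {c} m-even c-odd gcd≢1 = record
  { t = g ; 2≤t = ≢0∧≢1⇒≥2 g≢0 gcd≢1 ; p = p ; o = o ; m≡p*t = m≡p*g ; p-even = p-even
  ; c≡o*t = c≡o*g ; o-odd = proj₁ odd-factors }
  where
  g = gcd m c
  g≢0 : g ≢ 0
  g≢0 = gcd[m,n]≢0 m c (inj₁ (ℕ.≢-nonZero⁻¹ m))
  p = _∣_.quotient (gcd[m,n]∣m m c)
  m≡p*g = _∣_.equality (gcd[m,n]∣m m c)
  o = _∣_.quotient (gcd[m,n]∣n m c)
  c≡o*g = _∣_.equality (gcd[m,n]∣n m c)
  odd-factors : sgn o ≡ -1ℚ × sgn g ≡ -1ℚ
  odd-factors = sgn-odd-factors o g (trans (cong sgn (sym c≡o*g)) c-odd)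
  p-even : sgn p ≡ 1ℚ
  p-even = trans (sym (sgn-*-odd (proj₂ odd-factors) p)) (trans (cong sgn (sym m≡p*g)) m-even)

v2<⇒testDivisor : ∀ {m d} → 1 ≤ m → 1 ≤ d → sgn d ≡ 1ℚ → v2 d < v2 m → TestDivisor m d
v2<⇒testDivisor {m} {d} 1≤m 1≤d d-even vd<vm with v2-odd-part m 1≤m | v2-odd-part d 1≤d
... | om , m≡ , _ | od , d≡ , od-odd = record
  { t = t ; 2≤t = ≢0∧≢1⇒≥2 t≢0 t≢1 ; p = 2 ^ e * om * 2 ; o = od ; m≡p*t = m≡p*t
  ; p-even = sgn-*-even refl (2 ^ e * om) ; c≡o*t = trans d≡ (ℕP.*-comm t od) ; o-odd = sgn-odd {od} od-odd }
  where
  open ≡-Reasoning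
  vd = v2 d
  vm = v2 m
  t = 2 ^ vd
  e = vm ∸ suc vd
  t≢0 : t ≢ 0
  t≢0 = ℕ.≢-nonZero⁻¹ t {{ℕP.m^n≢0 2 vd}}
  t≢1 : t ≢ 1
  t≢1 t≡1 = 1≢-1 (begin
    1ℚ                 ≡⟨ d-even ⟨
    sgn d              ≡⟨ cong sgn (trans d≡ (cong (_* od) t≡1)) ⟩
    sgn (1 * od)       ≡⟨ cong sgn (ℕP.*-identityˡ od) ⟩
    sgn od             ≡⟨ sgn-odd {od} od-odd ⟩
    -1ℚ                ∎)
  m≡p*t : m ≡ 2 ^ e * om * 2 * t
  m≡p*t = begin
    m                          ≡⟨ m≡ ⟩
    2 ^ vm * om                ≡⟨ cong (λ v → 2 ^ v * om) (ℕP.m+[n∸m]≡n vd<vm) ⟨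
    2 ^ (suc vd + e) * om      ≡⟨ cong (_* om) (ℕP.^-distribˡ-+-* 2 (suc vd) e) ⟩
    2 * t * 2 ^ e * om         ≡⟨ regroup t (2 ^ e) om ⟩
    2 ^ e * om * 2 * t         ∎
    where
    regroup : ∀ x y z → 2 * x * y * z ≡ y * z * 2 * x
    regroup = ℕ-Solver.solve-∀

v2≤⇒oddMultiple : ∀ {m d} → 1 ≤ m → 1 ≤ d → v2 m ≤ v2 d → ∃[ o ] m ∣ o * d × o % 2 ≡ 1
v2≤⇒oddMultiple {m} {d} 1≤m 1≤d vm≤vd with v2-odd-part m 1≤m | v2-odd-part d 1≤d
... | om , m≡ , om-odd | od , d≡ , _ = om , divides (2 ^ (v2 d ∸ v2 m) * od) (begin
    om * d                                       ≡⟨ cong (om *_) d≡ ⟩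
    om * (2 ^ v2 d * od)                         ≡⟨ cong (λ v → om * (2 ^ v * od)) (ℕP.m+[n∸m]≡n vm≤vd) ⟨
    om * (2 ^ (v2 m + (v2 d ∸ v2 m)) * od)       ≡⟨ cong (λ x → om * (x * od)) (ℕP.^-distribˡ-+-* 2 (v2 m) _) ⟩
    om * (2 ^ v2 m * 2 ^ (v2 d ∸ v2 m) * od)     ≡⟨ regroup om (2 ^ v2 m) (2 ^ (v2 d ∸ v2 m)) od ⟩
    2 ^ (v2 d ∸ v2 m) * od * (2 ^ v2 m * om)     ≡⟨ cong (2 ^ (v2 d ∸ v2 m) * od *_) m≡ ⟨
    2 ^ (v2 d ∸ v2 m) * od * m                   ∎) , om-odd
  where
  open ≡-Reasoning
  regroup : ∀ w x y z → w * (x * y * z) ≡ y * z * (x * w)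
  regroup = ℕ-Solver.solve-∀

module NutCharacterisation (m a b : ℕ) .{{_ : NonZero m}} (2∣m : 2 ∣ m) (0<a : 0 < a) (a<b : a < b) (b<m : b < m) where
  open B3Kernel m a b 2∣m 0<a a<b b<m

  m-even : sgn m ≡ 1ℚ
  m-even = sgn-even 2∣m

  d-even : sgn a ≡ sgn b → sgn d ≡ 1ℚ
  d-even same = trans (sgn-∸ (ℕP.<⇒≤ a<b)) (trans (cong (sgn a *ℚ_) (sym same)) (sgn*sgn a))

  companion-sgn : sgn b ≡ -1ℚ → sgn d ≡ 1ℚ → ∀ j → companion sgn j ≡ - sgn (j + r)
  companion-sgn b-odd d-even j = begin
    - (sgn (j + r) +ℚ (sgn (j + r + d) +ℚ sgn (j + r + b)))
      ≡⟨ cong (λ t → - (sgn (j + r) +ℚ t)) (cong₂ _+ℚ_ (sgn-shift d-even (j + r)) (sgn-shift b-odd (j + r))) ⟩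
    - (sgn (j + r) +ℚ (sgn (j + r) *ℚ 1ℚ +ℚ sgn (j + r) *ℚ -1ℚ))
      ≡⟨ collapse (sgn (j + r)) ⟩
    - sgn (j + r) ∎
    where
    open ≡-Reasoning
    collapse : ∀ x → - (x +ℚ (x *ℚ 1ℚ +ℚ x *ℚ -1ℚ)) ≡ - x
    collapse = solve-∀ ℚ-ring

  nut-if : sgn a ≡ -1ℚ → sgn b ≡ -1ℚ → gcd m a ≡ 1 → gcd m b ≡ 1 → ∀ {o} → m ∣ o * d → o % 2 ≡ 1 →
           IsNut (B3 m a b)
  nut-if a-odd b-odd gcd-a gcd-b {o} m∣od o-odd = z , z≢0 , Φ⇒kernel (sgn-periodic m-even) Φsgn≡0 , spans
    where
    z = fromParts sgn (companion sgn)
    Φsgn≡0 : ∀ k → Φ sgn k ≡ 0ℚ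
    Φsgn≡0 = Φ-killed-by-b sgn (1+T^-sgn b-odd)
    z≢0 : ∀ u → z u ≢ 0ℚ
    z≢0 = ↑-cases
      (λ i e → sgn≢0 (toℕ i) (trans (sym (fromParts-x sgn (companion sgn) i)) e))
      (λ j e → sgn≢0 (toℕ j + r) (ℚP.neg-injective (begin
        - sgn (toℕ j + r)                  ≡⟨ companion-sgn b-odd (d-even (trans a-odd (sym b-odd))) (toℕ j) ⟨
        companion sgn (toℕ j)              ≡⟨ fromParts-y sgn (companion sgn) j ⟨
        z (m ↑ʳ j)                         ≡⟨ e ⟩
        0ℚ                                 ∎)))
      where open ≡-Reasoning
    spans : ∀ y → InKernel (B3 m a b) y → ∃[ c ] ∀ u → y u ≡ c *ℚ z u
    spans y y-kernel = c , ↑-cases y-x y-y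
      where
      X = xPart y
      c = X 0
      X≗c·sgn : ∀ k → X k ≡ c *ℚ sgn k
      X≗c·sgn = triple-kernel⇒alternating {o = o} m-even a-odd b-odd gcd-a gcd-b m∣od o-odd
                  (xPart-periodic y) (proj₁ (kernel⇒Φ y-kernel))
      y-x : ∀ i → y (i ↑ˡ m) ≡ c *ℚ z (i ↑ˡ m)
      y-x i = begin
        y (i ↑ˡ m)                ≡⟨ xPart-↑ˡ y i ⟨
        X (toℕ i)                 ≡⟨ X≗c·sgn (toℕ i) ⟩
        c *ℚ sgn (toℕ i)          ≡⟨ cong (c *ℚ_) (fromParts-x sgn (companion sgn) i) ⟨
        c *ℚ z (i ↑ˡ m)           ∎
        where open ≡-Reasoning
      y-y : ∀ j → y (m ↑ʳ j) ≡ c *ℚ z (m ↑ʳ j)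
      y-y j = begin
        y (m ↑ʳ j)                    ≡⟨ yPart-↑ʳ y j ⟨
        yPart y (toℕ j)               ≡⟨ proj₂ (kernel⇒Φ y-kernel) (toℕ j) ⟩
        companion X (toℕ j)           ≡⟨ companion-linear c X≗c·sgn (toℕ j) ⟩
        c *ℚ companion sgn (toℕ j)    ≡⟨ cong (c *ℚ_) (fromParts-y sgn (companion sgn) j) ⟨
        c *ℚ z (m ↑ʳ j)               ∎
        where open ≡-Reasoning

  module Necessity (a≡b-mod-2 : a % 2 ≡ b % 2) (nut : IsNut (B3 m a b)) where
    z = proj₁ nut
    z≢0 = proj₁ (proj₂ nut)
    z-kernel = proj₁ (proj₂ (proj₂ nut))
    z-spans = proj₂ (proj₂ (proj₂ nut))
    X = xPart z

    X≢0 : ∀ k → X k ≢ 0ℚ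
    X≢0 k = z≢0 ((k mod m) ↑ˡ m)

    ΦX≡0 : ∀ k → Φ X k ≡ 0ℚ
    ΦX≡0 = proj₁ (kernel⇒Φ z-kernel)

    proportional : ∀ {Q} → Periodic m Q → (∀ k → Φ Q k ≡ 0ℚ) → ∃[ c ] ∀ k → Q k ≡ c *ℚ X k
    proportional {Q} per Φ≡0 with z-spans (fromParts Q (companion Q)) (Φ⇒kernel per Φ≡0)
    ... | c , w≡cz = c , λ k → begin
      Q k                                          ≡⟨ periodic-% per k ⟨
      Q (k % m)                                    ≡⟨ cong Q (FinP.toℕ-fromℕ< (m%n<n k m)) ⟨
      Q (toℕ (k mod m))                            ≡⟨ fromParts-x Q (companion Q) (k mod m) ⟨
      fromParts Q (companion Q) ((k mod m) ↑ˡ m)   ≡⟨ w≡cz ((k mod m) ↑ˡ m) ⟩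
      c *ℚ X k                                     ∎
      where open ≡-Reasoning

    -- The test vector vanishes at 1 but not at 0, so it is not a multiple of X.
    no-testDivisor : ∀ {c} → TestDivisor m c →
                     (∀ Q → (∀ k → 1+T^ c Q k ≡ 0ℚ) → ∀ k → Φ Q k ≡ 0ℚ) → ⊥
    no-testDivisor {c} divisor Φ-killed = ℚP.1≢0 (begin
      1ℚ            ≡⟨ Q-0 ⟨
      Q 0           ≡⟨ Q≗λX 0 ⟩
      λ′ *ℚ X 0     ≡⟨ cong (_*ℚ X 0) λ≡0 ⟩
      0ℚ *ℚ X 0     ≡⟨ ℚP.*-zeroˡ (X 0) ⟩
      0ℚ            ∎)
      where
      open ≡-Reasoning
      open TestDivisor divisor
      instance
        t≢0 : NonZero t
        t≢0 = ℕ.>-nonZero (ℕP.<-≤-trans (s≤s z≤n) 2≤t)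
      open TestVector t
      Q-periodic-m : Periodic m Q
      Q-periodic-m = subst (λ n → Periodic n Q) (sym m≡p*t) (Q-periodic {p} p-even)
      Q-antiperiodic-c : ∀ k → 1+T^ c Q k ≡ 0ℚ
      Q-antiperiodic-c = subst (λ n → ∀ k → 1+T^ n Q k ≡ 0ℚ) (sym c≡o*t) (Q-antiperiodic {o} o-odd)
      Q≗λX′ : ∃[ λ′ ] ∀ k → Q k ≡ λ′ *ℚ X k
      Q≗λX′ = proportional Q-periodic-m (Φ-killed Q Q-antiperiodic-c)
      λ′ = proj₁ Q≗λX′
      Q≗λX = proj₂ Q≗λX′
      λ≡0 : λ′ ≡ 0ℚ
      λ≡0 = p*q≡0⇒p≡0 (X≢0 1) (trans (sym (Q≗λX 1)) (Q-1 2≤t))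

    -- For even a and b, alternate X is a kernel vector with ratio 1 to X at 0 and −1 at 1.
    a-odd : a % 2 ≡ 1
    a-odd with parity a
    ... | inj₂ odd  = odd
    ... | inj₁ even = ⊥-elim (1≢-1 (trans λ≡1 λ≡-1))
      where
      a-even = sgn-even (m%n≡0⇒n∣m a 2 even)
      b-even = sgn-even (m%n≡0⇒n∣m b 2 (trans (sym a≡b-mod-2) even))
      Φ-twisted≡0 : ∀ k → Φ (alternate X) k ≡ 0ℚ
      Φ-twisted≡0 k = begin
        Φ (alternate X) k        ≡⟨ Φ-alternate a-even b-even (d-even (trans a-even (sym b-even))) X k ⟩
        sgn k *ℚ Φ X k           ≡⟨ cong (sgn k *ℚ_) (ΦX≡0 k) ⟩
        sgn k *ℚ 0ℚ              ≡⟨ ℚP.*-zeroʳ (sgn k) ⟩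
        0ℚ                       ∎
        where open ≡-Reasoning
      twisted = proportional (alternate-periodic m-even (xPart-periodic z)) Φ-twisted≡0
      λ≡1 : 1ℚ ≡ proj₁ twisted
      λ≡1 = *-cancelʳ-≡ (X≢0 0) (proj₂ twisted 0)
      λ≡-1 : proj₁ twisted ≡ -1ℚ
      λ≡-1 = sym (*-cancelʳ-≡ (X≢0 1) (proj₂ twisted 1))

    b-odd : b % 2 ≡ 1
    b-odd = trans (sym a≡b-mod-2) a-odd

    gcd-a : gcd m a ≡ 1
    gcd-a with gcd m a ℕ.≟ 1
    ... | yes gcd≡1 = gcd≡1
    ... | no  gcd≢1 =
      ⊥-elim (no-testDivisor (gcd≢1⇒testDivisor m-even (sgn-odd {a} a-odd) gcd≢1) Φ-killed-by-a)

    gcd-b : gcd m b ≡ 1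
    gcd-b with gcd m b ℕ.≟ 1
    ... | yes gcd≡1 = gcd≡1
    ... | no  gcd≢1 =
      ⊥-elim (no-testDivisor (gcd≢1⇒testDivisor m-even (sgn-odd {b} b-odd) gcd≢1) Φ-killed-by-b)

    v2-bound : v2 m ≤ v2 d
    v2-bound with v2 m ℕ.≤? v2 d
    ... | yes ≤ = ≤
    ... | no  ≰ = ⊥-elim (no-testDivisor
      (v2<⇒testDivisor (ℕ.>-nonZero⁻¹ m) (ℕP.m<n⇒0<n∸m a<b)
        (d-even (trans (sgn-odd {a} a-odd) (sym (sgn-odd {b} b-odd)))) (ℕP.≰⇒> ≰))
      Φ-killed-by-d)

  NutConditions : Set
  NutConditions = a % 2 ≡ 1 × b % 2 ≡ 1 × gcd m a ≡ 1 × gcd m b ≡ 1 × v2 m ≤ v2 d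

  necessary : a % 2 ≡ b % 2 → IsNut (B3 m a b) → NutConditions
  necessary a≡b-mod-2 nut = a-odd , b-odd , gcd-a , gcd-b , v2-bound
    where open Necessity a≡b-mod-2 nut

  sufficient : NutConditions → IsNut (B3 m a b)
  sufficient (a-odd , b-odd , gcd-a , gcd-b , v2-bound)
    with v2≤⇒oddMultiple (ℕ.>-nonZero⁻¹ m) (ℕP.m<n⇒0<n∸m a<b) v2-bound
  ... | o , m∣od , o-odd = nut-if (sgn-odd {a} a-odd) (sgn-odd {b} b-odd) gcd-a gcd-b {o} m∣od o-odd

theorem5p1 : (m a b : ℕ) → .{{_ : NonZero m}} → 4 ≤ m → 2 ∣ m → a % 2 ≡ b % 2 → 1 ≤ a → a < b → b < m →
    IsNut (B3 m a b) ⇔ (a % 2 ≡ 1 × b % 2 ≡ 1 × gcd m a ≡ 1 × gcd m b ≡ 1 × v2 m ≤ v2 (b ∸ a))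
theorem5p1 m a b _ 2∣m a≡b-mod-2 1≤a a<b b<m = mk⇔ (necessary a≡b-mod-2) sufficient
  where open NutCharacterisation m a b 2∣m 1≤a a<b b<m
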